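{- Let $n\ge3$ and $m\ge1$ be integers and let $o_1$ be the condition "$\frac{n^2-n+2m+2}{4}\in\mathbb{Z}$", $o_2$ its negation. Then $$Mcut(LP_{n,m})=\begin{cases}\frac{n^2-n+2m}{(2m-1)(n^2-n+1)} & \text{if } 2\le m\le\frac{n^2-n+4}{2},\\[2pt] \frac{4}{n^2-n+2m} & \text{if } o_1 \text{ and } m>\frac{n^2-n+4}{2},\\[2pt] \frac{4(n^2-n+2m)}{(n(n-1)+2(m-1))(n(n-1)+2(m+1))} & \text{if } o_2 \text{ and } m>\frac{n^2-n+4}{2},\\[2pt] \frac{n^2-n+2}{(n+1)(n-1)} & \text{if } m=1.\end{cases}$$
   Context: The lollipop graph $LP_{n,m}$ ($n\ge3,m\ge1$) is the unweighted graph with vertices $x_1,\dots,x_m,y_1,\dots,y_n$ and edges $x_ix_{i+1}$ ($1\le i\le m-1$), $y_iy_j$ for all $i\ne j$ (so $y_1,\dots,y_n$ form a complete graph $K_n$), and $x_my_1$. For a graph $G=(V,E)$ with degrees $d_v$: $vol(S)=\sum_{v\in S}d_v$; $cut(S,T)$ is the number of edges between disjoint $S,T$; $Ncut(S,T)=cut(S,T)(1/vol(S)+1/vol(T))$; $Mcut(G)=\min\{Ncut(S,V\setminus S):\emptyset\ne S\subsetneq V\}$. -}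

module Defs where

open import Data.Bool using (Bool; true; false; _∧_; _∨_; not; if_then_else_)
open import Data.Nat as ℕ using (ℕ; zero; suc; _+_; _*_; _∸_; _<ᵇ_; _≡ᵇ_)
open import Data.Fin using (Fin; toℕ)
open import Data.List using (List; map; allFin)
open import Data.Nat.ListAction using (sum)
open import Data.Integer using (+_)
open import Data.Rational as ℚ using (ℚ; _/_; _≤_)
open import Data.Product using (Σ; _×_; ∃)
open import Relation.Binary.PropositionalEquality using (_≡_)

-- Lollipop graph LP_{n,m} on vertex set Fin (m + n):
-- vertex with index i < m is x_{i+1}; vertex with index m + j is y_{j+1}.
-- Adjacency on indices a, b:
--   x_i x_{i+1}   : a < m, b < m, and b = a + 1 or a = b + 1
--   y_i y_j (i≠j) : m ≤ a, m ≤ b, a ≠ b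
--   x_m y_1       : {a, b} = {m - 1, m}
adjℕ : (m a b : ℕ) → Bool
adjℕ m a b =
  ((a <ᵇ m) ∧ (b <ᵇ m) ∧ ((suc a ≡ᵇ b) ∨ (suc b ≡ᵇ a)))
  ∨ (not (a <ᵇ m) ∧ not (b <ᵇ m) ∧ not (a ≡ᵇ b))
  ∨ ((suc a ≡ᵇ m) ∧ (b ≡ᵇ m))
  ∨ ((suc b ≡ᵇ m) ∧ (a ≡ᵇ m))

V : (n m : ℕ) → Set
V n m = Fin (m + n)

adj : (n m : ℕ) → V n m → V n m → Bool
adj n m u v = adjℕ m (toℕ u) (toℕ v)

b2n : Bool → ℕ
b2n true = 1
b2n false = 0

Σv : (n m : ℕ) → (V n m → ℕ) → ℕ
Σv n m f = sum (map f (allFin (m + n)))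

deg : (n m : ℕ) → V n m → ℕ
deg n m v = Σv n m (λ u → b2n (adj n m v u))

Subset : (n m : ℕ) → Set
Subset n m = V n m → Bool

compl : (n m : ℕ) → Subset n m → Subset n m
compl n m S v = not (S v)

vol : (n m : ℕ) → Subset n m → ℕ
vol n m S = Σv n m (λ v → if S v then deg n m v else 0)

cut : (n m : ℕ) → Subset n m → Subset n m → ℕ
cut n m S T = Σv n m (λ u → Σv n m (λ v → b2n (S u ∧ T v ∧ adj n m u v)))

-- p / q as a rational; q = 0 is sent to 0 (never used with q = 0 below)
frac : ℕ → ℕ → ℚ
frac p zero = ℚ.0ℚ
frac p (suc q) = (+ p) / suc q

inv : ℕ → ℚ
inv q = frac 1 q

Ncut : (n m : ℕ) → Subset n m → Subset n m → ℚ
Ncut n m S T = frac (cut n m S T) 1 ℚ.* (inv (vol n m S) ℚ.+ inv (vol n m T))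

Proper : (n m : ℕ) → Subset n m → Set
Proper n m S = (∃ λ v → S v ≡ true) × (∃ λ v → S v ≡ false)

IsMcut : (n m : ℕ) → ℚ → Set
IsMcut n m q =
  (Σ (Subset n m) λ S → Proper n m S × (Ncut n m S (compl n m S) ≡ q))
  × ((S : Subset n m) → Proper n m S → q ≤ Ncut n m S (compl n m S))

module Submission where

-- Write n = 3 + q, p = n - 1 and A = n(n - 1).  A vertex set S is described by
-- a few counts: R, the endpoints of path steps x_i x_{i+1} (and x_m y_1) lying
-- in S; s, the clique vertices in S; and T, the path steps leaving S.  Summing
-- over the edges of LP_{n,m} gives
--   vol S = R + s p,   cut(S, V∖S) = T + s s′,   vol S + vol (V∖S) = W = 2m + A.
-- With c the cut and v, v′ the two volumes, Ncut = c W / (v v′), so a bound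
-- Ncut ≥ P / Q is the inequality P v v′ ≤ c W Q between naturals.  Every proper
-- S has one of three shapes: the clique is split (then c ≥ s s′), or it lies on
-- one side and at least two path steps are cut (c ≥ 2), or a single step is cut
-- and one side is a path prefix, of odd volume.  Each case of the theorem is an
-- inequality for the three shapes (AM-GM being the main tool) plus an initial
-- segment of vertices attaining it: the whole path for a short path, a path
-- prefix of volume about W / 2 for a long one, and {x_1, y_1} for m = 1.

open import Defs
open import Data.Nat using (ℕ; _+_; _*_; _∸_; _≤_; _<_)
open import Data.Nat.Divisibility using (_∣_)
open import Data.Product using (_×_)
open import Relation.Nullary using (¬_)
open import Relation.Binary.PropositionalEquality using (_≡_)

open import Data.Bool using (Bool; true; false; _∧_; _∨_; not; if_then_else_)
open import Data.Bool.Properties using (∧-zeroʳ; T-≡)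
open import Function.Bundles using (module Equivalence)
open import Data.Nat using (zero; suc; pred; _<ᵇ_; _≡ᵇ_; z≤n; s≤s; >-nonZero)
open import Data.Nat.Properties
open import Data.Nat.Tactic.RingSolver using (solve-∀)
open import Data.Nat.Divisibility using (divides)
open import Data.Fin using (Fin; toℕ; fromℕ<) renaming (zero to fzero; suc to fsuc)
open import Data.Fin.Properties using (toℕ<n; toℕ-fromℕ<)
open import Data.List using (map; allFin; tabulate)
open import Data.List.Properties using (map-tabulate)
open import Data.Nat.ListAction using (sum)
import Data.Integer as ℤ
open import Data.Integer.Properties using (pos-*)
open import Data.Rational as ℚ using (toℚᵘ)
import Data.Rational.Properties as ℚP
open import Data.Rational.Unnormalised as ℚᵘ using (mkℚᵘ; *≡*; *≤*)
import Data.Rational.Unnormalised.Properties as ℚᵘP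
open import Data.Product using (Σ; ∃; _,_; proj₁; proj₂)
open import Data.Sum using (_⊎_; inj₁; inj₂; [_,_]′)
open import Data.Empty using (⊥; ⊥-elim)
open import Relation.Nullary using (yes; no)
open import Relation.Binary using (tri<; tri≈; tri>)
open import Relation.Binary.PropositionalEquality
  using (refl; sym; trans; cong; cong₂; subst; subst₂; _≢_; module ≡-Reasoning)

-- ∑ N g = g 0 + g 1 + … + g (N - 1).  All counting in the proof is done
-- with this index-based sum, which is easier to split and reindex than a
-- sum over Fin.
∑ : ℕ → (ℕ → ℕ) → ℕ
∑ zero    g = 0
∑ (suc N) g = g 0 + ∑ N (λ i → g (suc i))

∑-cong : ∀ N {g h : ℕ → ℕ} → (∀ i → i < N → g i ≡ h i) → ∑ N g ≡ ∑ N h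
∑-cong zero    eq = refl
∑-cong (suc N) eq = cong₂ _+_ (eq 0 (s≤s z≤n)) (∑-cong N (λ i i<N → eq (suc i) (s≤s i<N)))

∑-ext : ∀ N {g h : ℕ → ℕ} → (∀ i → g i ≡ h i) → ∑ N g ≡ ∑ N h
∑-ext N eq = ∑-cong N (λ i _ → eq i)

∑-split : ∀ a b (g : ℕ → ℕ) → ∑ (a + b) g ≡ ∑ a g + ∑ b (λ i → g (a + i))
∑-split zero    b g = refl
∑-split (suc a) b g =
  trans (cong (g 0 +_) (∑-split a b (λ i → g (suc i)))) (sym (+-assoc (g 0) _ _))

∑-+ : ∀ N (g h : ℕ → ℕ) → ∑ N (λ i → g i + h i) ≡ ∑ N g + ∑ N h
∑-+ zero    g h = refl
∑-+ (suc N) g h =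
  trans (cong (g 0 + h 0 +_) (∑-+ N (λ i → g (suc i)) (λ i → h (suc i))))
        (+-+-comm (g 0) (h 0) _ _)
  where
  +-+-comm : ∀ a b c d → a + b + (c + d) ≡ a + c + (b + d)
  +-+-comm = solve-∀

∑-*ˡ : ∀ N c (g : ℕ → ℕ) → ∑ N (λ i → c * g i) ≡ c * ∑ N g
∑-*ˡ zero    c g = sym (*-zeroʳ c)
∑-*ˡ (suc N) c g =
  trans (cong (c * g 0 +_) (∑-*ˡ N c (λ i → g (suc i)))) (sym (*-distribˡ-+ c (g 0) _))

∑-*ʳ : ∀ N c (g : ℕ → ℕ) → ∑ N (λ i → g i * c) ≡ ∑ N g * c
∑-*ʳ N c g = trans (∑-ext N (λ i → *-comm (g i) c)) (trans (∑-*ˡ N c g) (*-comm c _))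

∑-const : ∀ N c → ∑ N (λ _ → c) ≡ N * c
∑-const zero    c = refl
∑-const (suc N) c = cong (c +_) (∑-const N c)

∑-zero : ∀ N → ∑ N (λ _ → 0) ≡ 0
∑-zero N = trans (∑-const N 0) (*-zeroʳ N)

∑-swap : ∀ N M (G : ℕ → ℕ → ℕ) → ∑ N (λ i → ∑ M (G i)) ≡ ∑ M (λ j → ∑ N (λ i → G i j))
∑-swap zero    M G = sym (∑-zero M)
∑-swap (suc N) M G =
  trans (cong (∑ M (G 0) +_) (∑-swap N M (λ i → G (suc i))))
        (sym (∑-+ M (G 0) (λ j → ∑ N (λ i → G (suc i) j))))

∑-mono : ∀ N {g h : ℕ → ℕ} → (∀ i → i < N → g i ≤ h i) → ∑ N g ≤ ∑ N h
∑-mono zero    le = z≤n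
∑-mono (suc N) le = +-mono-≤ (le 0 (s≤s z≤n)) (∑-mono N (λ i i<N → le (suc i) (s≤s i<N)))

∑≡0⇒ : ∀ N (g : ℕ → ℕ) → ∑ N g ≡ 0 → ∀ i → i < N → g i ≡ 0
∑≡0⇒ (suc N) g eq zero    _         = m+n≡0⇒m≡0 (g 0) eq
∑≡0⇒ (suc N) g eq (suc i) (s≤s i<N) = ∑≡0⇒ N (λ j → g (suc j)) (m+n≡0⇒n≡0 (g 0) eq) i i<N

∑-point : ∀ N k (h : ℕ → ℕ) → k < N → ∑ N (λ j → b2n (k ≡ᵇ j) * h j) ≡ h k
∑-point (suc N) zero    h _ = trans (cong₂ _+_ (+-identityʳ (h 0)) (∑-zero N)) (+-identityʳ (h 0))
∑-point (suc N) (suc k) h (s≤s k<N) = ∑-point N k (λ j → h (suc j)) k<N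

∑-except : ∀ N k (h : ℕ → ℕ) → k < N → ∑ N (λ j → b2n (not (k ≡ᵇ j)) * h j) + h k ≡ ∑ N h
∑-except N k h k<N = begin
    ∑ N (λ j → b2n (not (k ≡ᵇ j)) * h j) + h k
  ≡⟨ cong (∑ N (λ j → b2n (not (k ≡ᵇ j)) * h j) +_) (sym (∑-point N k h k<N)) ⟩
    ∑ N (λ j → b2n (not (k ≡ᵇ j)) * h j) + ∑ N (λ j → b2n (k ≡ᵇ j) * h j)
  ≡⟨ sym (∑-+ N _ _) ⟩
    ∑ N (λ j → b2n (not (k ≡ᵇ j)) * h j + b2n (k ≡ᵇ j) * h j)
  ≡⟨ ∑-ext N (λ j → complementary (k ≡ᵇ j) (h j)) ⟩
    ∑ N h
  ∎
  where
  open ≡-Reasoning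
  complementary : ∀ x y → b2n (not x) * y + b2n x * y ≡ y
  complementary true  y = +-identityʳ y
  complementary false y = trans (+-identityʳ (1 * y)) (*-identityˡ y)

∑-allFin : ∀ N (f : Fin N → ℕ) (g : ℕ → ℕ) → (∀ u → f u ≡ g (toℕ u)) →
  sum (map f (allFin N)) ≡ ∑ N g
∑-allFin N f g eq = trans (cong sum (map-tabulate (λ x → x) f)) (tabulated N f g eq)
  where
  tabulated : ∀ N (f : Fin N → ℕ) (g : ℕ → ℕ) → (∀ u → f u ≡ g (toℕ u)) →
    sum (tabulate f) ≡ ∑ N g
  tabulated zero    f g eq = refl
  tabulated (suc N) f g eq =
    cong₂ _+_ (eq fzero) (tabulated N (λ u → f (fsuc u)) (λ i → g (suc i)) (λ u → eq (fsuc u)))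

-- The predicate on ℕ underlying a vertex set; indices ≥ N lie outside.
onℕ : ∀ N → (Fin N → Bool) → ℕ → Bool
onℕ zero    S i       = false
onℕ (suc N) S zero    = S fzero
onℕ (suc N) S (suc i) = onℕ N (λ u → S (fsuc u)) i

onℕ-toℕ : ∀ N (S : Fin N → Bool) u → onℕ N S (toℕ u) ≡ S u
onℕ-toℕ (suc N) S fzero    = refl
onℕ-toℕ (suc N) S (fsuc u) = onℕ-toℕ N (λ u → S (fsuc u)) u

onℕ-index : ∀ N (f : ℕ → Bool) i → i < N → onℕ N (λ u → f (toℕ u)) i ≡ f i
onℕ-index (suc N) f zero    _         = refl
onℕ-index (suc N) f (suc i) (s≤s i<N) = onℕ-index N (λ j → f (suc j)) i i<N

<ᵇ-true : ∀ {i m} → i < m → (i <ᵇ m) ≡ true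
<ᵇ-true i<m = Equivalence.to T-≡ (<⇒<ᵇ i<m)

<ᵇ-false : ∀ {a k} → k ≤ a → (a <ᵇ k) ≡ false
<ᵇ-false {a}     {zero}  _        = refl
<ᵇ-false {suc a} {suc k} (s≤s le) = <ᵇ-false le

+<ᵇ-false : ∀ m k → (m + k <ᵇ m) ≡ false
+<ᵇ-false m k = <ᵇ-false (m≤m+n m k)

+≡ᵇ+ : ∀ m a b → (m + a ≡ᵇ m + b) ≡ (a ≡ᵇ b)
+≡ᵇ+ zero    a b = refl
+≡ᵇ+ (suc m) a b = +≡ᵇ+ m a b

b2n-∧ : ∀ x y z → b2n (x ∧ y ∧ z) ≡ b2n z * (b2n x * b2n y)
b2n-∧ true  true  z = sym (*-identityʳ (b2n z))
b2n-∧ true  false z = sym (*-zeroʳ (b2n z))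
b2n-∧ false y     z = sym (*-zeroʳ (b2n z))

b2n-not : ∀ x → b2n x + b2n (not x) ≡ 1
b2n-not true  = refl
b2n-not false = refl

-- The edges are the "path steps" a — a+1 for a < m (the last of
-- them is x_m y_1) and the pairs of distinct clique vertices.
pathStep : ℕ → ℕ → ℕ → Bool
pathStep m a b = (a <ᵇ m) ∧ (suc a ≡ᵇ b)

cliquePair : ℕ → ℕ → ℕ → Bool
cliquePair m a b = not (a <ᵇ m) ∧ (not (b <ᵇ m) ∧ not (a ≡ᵇ b))

adj-decompose : ∀ m a b →
  b2n (adjℕ m a b) ≡ b2n (pathStep m a b) + b2n (pathStep m b a) + b2n (cliquePair m a b)
adj-decompose zero a b with a ≡ᵇ b
... | true  = refl
... | false = refl
adj-decompose (suc m) zero zero with m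
... | zero  = refl
... | suc _ = refl
adj-decompose (suc m) zero (suc zero) with m
... | zero  = refl
... | suc _ = refl
adj-decompose (suc m) zero (suc (suc b)) with m
... | zero   = refl
... | suc m′ rewrite ∧-zeroʳ (b <ᵇ m′) | ∧-zeroʳ (suc b ≡ᵇ m′) = refl
adj-decompose (suc m) (suc zero) zero with m
... | zero  = refl
... | suc _ = refl
adj-decompose (suc m) (suc (suc a)) zero with m
... | zero   = refl
... | suc m′ rewrite ∧-zeroʳ (a <ᵇ m′) | ∧-zeroʳ (suc a ≡ᵇ m′) | ∧-zeroʳ (not (a <ᵇ m′)) = refl
adj-decompose (suc m) (suc a) (suc b) = adj-decompose m a b

∑-pathStep : ∀ m d (F : ℕ → ℕ → ℕ) →
  ∑ (m + suc d) (λ i → ∑ (m + suc d) (λ j → b2n (pathStep m i j) * F i j)) ≡ ∑ m (λ i → F i (suc i))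
∑-pathStep m d F = begin
    ∑ N (λ i → ∑ N (λ j → b2n (pathStep m i j) * F i j))
  ≡⟨ ∑-split m (suc d) _ ⟩
    ∑ m (λ i → ∑ N (λ j → b2n (pathStep m i j) * F i j))
      + ∑ (suc d) (λ k → ∑ N (λ j → b2n (pathStep m (m + k) j) * F (m + k) j))
  ≡⟨ cong₂ _+_ (∑-cong m onPath) (trans (∑-ext (suc d) offPath) (∑-zero (suc d))) ⟩
    ∑ m (λ i → F i (suc i)) + 0
  ≡⟨ +-identityʳ _ ⟩
    ∑ m (λ i → F i (suc i))
  ∎
  where
  open ≡-Reasoning
  N = m + suc d
  m<N : m < N
  m<N = subst (m <_) (sym (+-suc m d)) (s≤s (m≤m+n m d))
  onPath : ∀ i → i < m → ∑ N (λ j → b2n (pathStep m i j) * F i j) ≡ F i (suc i)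
  onPath i i<m =
    trans (∑-ext N (λ j → cong (λ z → b2n (z ∧ (suc i ≡ᵇ j)) * F i j) (<ᵇ-true i<m)))
          (∑-point N (suc i) (F i) (≤-trans (s≤s i<m) m<N))
  offPath : ∀ k → ∑ N (λ j → b2n (pathStep m (m + k) j) * F (m + k) j) ≡ 0
  offPath k =
    trans (∑-ext N (λ j → cong (λ z → b2n (z ∧ (suc (m + k) ≡ᵇ j)) * F (m + k) j) (+<ᵇ-false m k)))
          (∑-zero N)

∑-cliquePair : ∀ m d (F : ℕ → ℕ → ℕ) →
  ∑ (m + d) (λ i → ∑ (m + d) (λ j → b2n (cliquePair m i j) * F i j))
  ≡ ∑ d (λ k → ∑ d (λ k′ → b2n (not (k ≡ᵇ k′)) * F (m + k) (m + k′)))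
∑-cliquePair m d F = begin
    ∑ N (λ i → ∑ N (λ j → b2n (cliquePair m i j) * F i j))
  ≡⟨ ∑-split m d _ ⟩
    ∑ m (λ i → ∑ N (λ j → b2n (cliquePair m i j) * F i j))
      + ∑ d (λ k → ∑ N (λ j → b2n (cliquePair m (m + k) j) * F (m + k) j))
  ≡⟨ cong₂ _+_ (trans (∑-cong m pathRow) (∑-zero m)) (∑-ext d cliqueRow) ⟩
    0 + ∑ d (λ k → ∑ d (λ k′ → b2n (not (k ≡ᵇ k′)) * F (m + k) (m + k′)))
  ∎
  where
  open ≡-Reasoning
  N = m + d
  pathRow : ∀ i → i < m → ∑ N (λ j → b2n (cliquePair m i j) * F i j) ≡ 0
  pathRow i i<m = trans (∑-ext N row) (∑-zero N)
    where
    row : ∀ j → b2n (cliquePair m i j) * F i j ≡ 0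
    row j rewrite <ᵇ-true i<m = refl
  cliqueRow : ∀ k → ∑ N (λ j → b2n (cliquePair m (m + k) j) * F (m + k) j)
                  ≡ ∑ d (λ k′ → b2n (not (k ≡ᵇ k′)) * F (m + k) (m + k′))
  cliqueRow k = begin
      ∑ N (λ j → b2n (cliquePair m (m + k) j) * F (m + k) j)
    ≡⟨ ∑-split m d _ ⟩
      ∑ m (λ j → b2n (cliquePair m (m + k) j) * F (m + k) j)
        + ∑ d (λ k′ → b2n (cliquePair m (m + k) (m + k′)) * F (m + k) (m + k′))
    ≡⟨ cong₂ _+_ (trans (∑-cong m toPath) (∑-zero m))
                 (∑-ext d (λ k′ → cong (_* F (m + k) (m + k′)) (toClique k′))) ⟩
      0 + ∑ d (λ k′ → b2n (not (k ≡ᵇ k′)) * F (m + k) (m + k′))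
    ∎
    where
    inClique : (m + k <ᵇ m) ≡ false
    inClique = +<ᵇ-false m k
    toPath : ∀ j → j < m → b2n (cliquePair m (m + k) j) * F (m + k) j ≡ 0
    toPath j j<m rewrite inClique | <ᵇ-true j<m = refl
    toClique : ∀ k′ → b2n (cliquePair m (m + k) (m + k′)) ≡ b2n (not (k ≡ᵇ k′))
    toClique k′ rewrite inClique | +<ᵇ-false m k′ | +≡ᵇ+ m k k′ = refl

∑-edges : ∀ m d (F : ℕ → ℕ → ℕ) →
  ∑ (m + suc d) (λ i → ∑ (m + suc d) (λ j → b2n (adjℕ m i j) * F i j))
  ≡ ∑ m (λ i → F i (suc i)) + ∑ m (λ i → F (suc i) i)
    + ∑ (suc d) (λ k → ∑ (suc d) (λ k′ → b2n (not (k ≡ᵇ k′)) * F (m + k) (m + k′)))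
∑-edges m d F = begin
    ∑ N (λ i → ∑ N (λ j → b2n (adjℕ m i j) * F i j))
  ≡⟨ ∑-ext N (λ i → trans (∑-ext N (λ j → distribute i j)) (∑-+₃ N _ _ _)) ⟩
    ∑ N (λ i → fwd i + bwd i + clq i)
  ≡⟨ ∑-+₃ N fwd bwd clq ⟩
    ∑ N fwd + ∑ N bwd + ∑ N clq
  ≡⟨ cong₂ _+_ (cong₂ _+_ (∑-pathStep m d F)
                          (trans (∑-swap N N _) (∑-pathStep m d (λ j i → F i j))))
               (∑-cliquePair m (suc d) F) ⟩
    ∑ m (λ i → F i (suc i)) + ∑ m (λ i → F (suc i) i)
      + ∑ (suc d) (λ k → ∑ (suc d) (λ k′ → b2n (not (k ≡ᵇ k′)) * F (m + k) (m + k′)))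
  ∎
  where
  open ≡-Reasoning
  N = m + suc d
  fwd bwd clq : ℕ → ℕ
  fwd i = ∑ N (λ j → b2n (pathStep m i j) * F i j)
  bwd i = ∑ N (λ j → b2n (pathStep m j i) * F i j)
  clq i = ∑ N (λ j → b2n (cliquePair m i j) * F i j)
  ∑-+₃ : ∀ M (g h k : ℕ → ℕ) → ∑ M (λ i → g i + h i + k i) ≡ ∑ M g + ∑ M h + ∑ M k
  ∑-+₃ M g h k = trans (∑-+ M (λ i → g i + h i) k) (cong (_+ ∑ M k) (∑-+ M g h))
  distribute : ∀ i j → b2n (adjℕ m i j) * F i j
    ≡ b2n (pathStep m i j) * F i j + b2n (pathStep m j i) * F i j + b2n (cliquePair m i j) * F i j
  distribute i j rewrite adj-decompose m i j =
    trans (*-distribʳ-+ (F i j) (b2n (pathStep m i j) + b2n (pathStep m j i)) _)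
          (cong (_+ b2n (cliquePair m i j) * F i j) (*-distribʳ-+ (F i j) (b2n (pathStep m i j)) _))

-- Volume and cut in terms of counts

-- For a vertex set with indicator b on indices:
--   pathEnds    = endpoints of path steps lying in the set, with multiplicity;
--   cliqueCount = number of clique vertices in the set;
--   pathCut     = number of path steps leaving the set.
pathEnds : ℕ → (ℕ → Bool) → ℕ
pathEnds m b = ∑ m (λ i → b2n (b i)) + ∑ m (λ i → b2n (b (suc i)))

cliqueCount : ℕ → ℕ → (ℕ → Bool) → ℕ
cliqueCount m n b = ∑ n (λ k → b2n (b (m + k)))

pathCut : ℕ → (ℕ → Bool) → ℕ
pathCut m b = ∑ m (λ i → b2n (b i) * b2n (not (b (suc i))))
            + ∑ m (λ i → b2n (b (suc i)) * b2n (not (b i)))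

complᵇ : (ℕ → Bool) → ℕ → Bool
complᵇ b i = not (b i)

-- Each clique vertex has degree p in the clique, so
-- vol(S) = pathEnds + p · cliqueCount  on the clique K_{p+1}.
vol-counts : ∀ p m (S : Subset (suc p) m) (b : ℕ → Bool) → (∀ u → S u ≡ b (toℕ u)) →
  vol (suc p) m S ≡ pathEnds m b + cliqueCount m (suc p) b * p
vol-counts p m S b eq = begin
    vol (suc p) m S
  ≡⟨ ∑-allFin N _ (λ i → if b i then ∑ N (λ j → b2n (adjℕ m i j)) else 0) asIndex ⟩
    ∑ N (λ i → if b i then ∑ N (λ j → b2n (adjℕ m i j)) else 0)
  ≡⟨ ∑-ext N (λ i → weighted (b i) _) ⟩
    ∑ N (λ i → ∑ N (λ j → b2n (adjℕ m i j) * b2n (b i)))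
  ≡⟨ ∑-edges m p (λ i j → b2n (b i)) ⟩
    pathEnds m b + ∑ (suc p) (λ k → ∑ (suc p) (λ k′ → b2n (not (k ≡ᵇ k′)) * b2n (b (m + k))))
  ≡⟨ cong (pathEnds m b +_)
          (trans (∑-cong (suc p) cliqueDegree) (∑-*ʳ (suc p) p (λ k → b2n (b (m + k))))) ⟩
    pathEnds m b + cliqueCount m (suc p) b * p
  ∎
  where
  open ≡-Reasoning
  N = m + suc p
  asIndex : ∀ u → (if S u then deg (suc p) m u else 0)
                ≡ (if b (toℕ u) then ∑ N (λ j → b2n (adjℕ m (toℕ u) j)) else 0)
  asIndex u rewrite eq u = cong (λ z → if b (toℕ u) then z else 0) (∑-allFin N _ _ (λ _ → refl))
  weighted : ∀ (x : Bool) (h : ℕ → ℕ) → (if x then ∑ N h else 0) ≡ ∑ N (λ j → h j * b2n x)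
  weighted true  h = sym (∑-ext N (λ j → *-identityʳ (h j)))
  weighted false h = sym (trans (∑-ext N (λ j → *-zeroʳ (h j))) (∑-zero N))
  cliqueDegree : ∀ k → k < suc p → ∑ (suc p) (λ k′ → b2n (not (k ≡ᵇ k′)) * b2n (b (m + k)))
                                 ≡ b2n (b (m + k)) * p
  cliqueDegree k k<n = trans
    (+-cancelʳ-≡ c _ _ (trans (∑-except (suc p) k (λ _ → c) k<n)
                              (trans (∑-const (suc p) c) (+-comm c (p * c)))))
    (*-comm p c)
    where c = b2n (b (m + k))

-- A clique vertex in S is joined to every clique vertex outside S, so
-- cut(S, V∖S) = pathCut + cliqueCount(S) · cliqueCount(V∖S).
cut-counts : ∀ p m (S : Subset (suc p) m) (b : ℕ → Bool) → (∀ u → S u ≡ b (toℕ u)) →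
  cut (suc p) m S (compl (suc p) m S)
  ≡ pathCut m b + cliqueCount m (suc p) b * cliqueCount m (suc p) (complᵇ b)
cut-counts p m S b eq = begin
    cut (suc p) m S (compl (suc p) m S)
  ≡⟨ ∑-allFin N _ (λ i → ∑ N (λ j → b2n (b i ∧ not (b j) ∧ adjℕ m i j))) asIndex ⟩
    ∑ N (λ i → ∑ N (λ j → b2n (b i ∧ not (b j) ∧ adjℕ m i j)))
  ≡⟨ ∑-ext N (λ i → ∑-ext N (λ j → b2n-∧ (b i) (not (b j)) (adjℕ m i j))) ⟩
    ∑ N (λ i → ∑ N (λ j → b2n (adjℕ m i j) * (b2n (b i) * b2n (not (b j)))))
  ≡⟨ ∑-edges m p (λ i j → b2n (b i) * b2n (not (b j))) ⟩
    pathCut m b + ∑ (suc p) (λ k → ∑ (suc p) (λ k′ → b2n (not (k ≡ᵇ k′)) * (x k * y k′)))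
  ≡⟨ cong (pathCut m b +_) (trans (∑-cong (suc p) crossing) (∑-*ʳ (suc p) (∑ (suc p) y) x)) ⟩
    pathCut m b + cliqueCount m (suc p) b * cliqueCount m (suc p) (complᵇ b)
  ∎
  where
  open ≡-Reasoning
  N = m + suc p
  x y : ℕ → ℕ
  x k = b2n (b (m + k))
  y k = b2n (not (b (m + k)))
  asIndex : ∀ u → Σv (suc p) m (λ v → b2n (S u ∧ compl (suc p) m S v ∧ adj (suc p) m u v))
                ≡ ∑ N (λ j → b2n (b (toℕ u) ∧ not (b j) ∧ adjℕ m (toℕ u) j))
  asIndex u = ∑-allFin N _ _
    (λ w → cong₂ (λ s t → b2n (s ∧ not t ∧ adjℕ m (toℕ u) (toℕ w))) (eq u) (eq w))
  -- the term k′ = k vanishes because x k * y k = 0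
  crossing : ∀ k → k < suc p →
    ∑ (suc p) (λ k′ → b2n (not (k ≡ᵇ k′)) * (x k * y k′)) ≡ x k * ∑ (suc p) y
  crossing k k<n with b (m + k) in bk
  ... | false = trans (∑-ext (suc p) (λ k′ → *-zeroʳ (b2n (not (k ≡ᵇ k′))))) (∑-zero (suc p))
  ... | true  = begin
      ∑ (suc p) (λ k′ → b2n (not (k ≡ᵇ k′)) * (1 * y k′))
    ≡⟨ ∑-ext (suc p) (λ k′ → cong (b2n (not (k ≡ᵇ k′)) *_) (*-identityˡ (y k′))) ⟩
      ∑ (suc p) (λ k′ → b2n (not (k ≡ᵇ k′)) * y k′)
    ≡⟨ sym (trans (cong (λ z → rest + b2n (not z)) bk) (+-identityʳ rest)) ⟩
      rest + y k
    ≡⟨ ∑-except (suc p) k y k<n ⟩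
      ∑ (suc p) y
    ≡⟨ sym (*-identityˡ _) ⟩
      1 * ∑ (suc p) y
    ∎
    where rest = ∑ (suc p) (λ k′ → b2n (not (k ≡ᵇ k′)) * y k′)

-- Every path step has two endpoints, each in S or in V∖S.
pathEnds-compl : ∀ m b → pathEnds m b + pathEnds m (complᵇ b) ≡ m + m
pathEnds-compl m b =
  trans (+-+-comm (∑ m (λ i → b2n (b i))) _ _ _)
        (cong₂ _+_ (all-ones (λ i → b i)) (all-ones (λ i → b (suc i))))
  where
  +-+-comm : ∀ a b c d → a + b + (c + d) ≡ a + c + (b + d)
  +-+-comm = solve-∀
  all-ones : ∀ (f : ℕ → Bool) → ∑ m (λ i → b2n (f i)) + ∑ m (λ i → b2n (not (f i))) ≡ m
  all-ones f = trans (sym (∑-+ m _ _))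
    (trans (∑-ext m (λ i → b2n-not (f i))) (trans (∑-const m 1) (*-identityʳ m)))

cliqueCount-compl : ∀ m n b → cliqueCount m n b + cliqueCount m n (complᵇ b) ≡ n
cliqueCount-compl m n b = trans (sym (∑-+ n _ _))
  (trans (∑-ext n (λ k → b2n-not (b (m + k)))) (trans (∑-const n 1) (*-identityʳ n)))

-- A step leaving S has one endpoint in S and one in V∖S.
pathCut≤pathEnds : ∀ m b → pathCut m b ≤ pathEnds m b
pathCut≤pathEnds m b =
  +-mono-≤ (∑-mono m (λ i _ → inFirst (b i) _)) (∑-mono m (λ i _ → inFirst (b (suc i)) _))
  where
  inFirst : ∀ x y → b2n x * b2n y ≤ b2n x
  inFirst true  true  = s≤s z≤n
  inFirst true  false = z≤n
  inFirst false y     = z≤n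

pathCut≤pathEnds-compl : ∀ m b → pathCut m b ≤ pathEnds m (complᵇ b)
pathCut≤pathEnds-compl m b = subst (pathCut m b ≤_) (+-comm (∑ m (λ i → b2n (not (b (suc i))))) _)
  (+-mono-≤ (∑-mono m (λ i _ → inSecond (b i) _)) (∑-mono m (λ i _ → inSecond (b (suc i)) _)))
  where
  inSecond : ∀ x y → b2n x * b2n y ≤ b2n y
  inSecond true  true  = s≤s z≤n
  inSecond true  false = z≤n
  inSecond false y     = z≤n

-- pathEnds + pathCut counts each step meeting S exactly twice, so it is even.
pathEnds+pathCut-even : ∀ m b → ∃ λ E → pathEnds m b + pathCut m b ≡ E + E
pathEnds+pathCut-even m b = ∑ m meets , (begin
    pathEnds m b + pathCut m b
  ≡⟨ +-+-comm (∑ m (λ i → b2n (b i))) _ _ _ ⟩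
    (∑ m (λ i → b2n (b i)) + ∑ m out) + (∑ m (λ i → b2n (b (suc i))) + ∑ m into)
  ≡⟨ sym (cong₂ _+_ (∑-+ m _ _) (∑-+ m _ _)) ⟩
    ∑ m (λ i → b2n (b i) + out i) + ∑ m (λ i → b2n (b (suc i)) + into i)
  ≡⟨ sym (∑-+ m _ _) ⟩
    ∑ m (λ i → b2n (b i) + out i + (b2n (b (suc i)) + into i))
  ≡⟨ ∑-ext m (λ i → twice (b i) (b (suc i))) ⟩
    ∑ m (λ i → meets i + meets i)
  ≡⟨ ∑-+ m meets meets ⟩
    ∑ m meets + ∑ m meets
  ∎)
  where
  open ≡-Reasoning
  out into meets : ℕ → ℕ
  out   i = b2n (b i) * b2n (not (b (suc i)))
  into  i = b2n (b (suc i)) * b2n (not (b i))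
  meets i = b2n (b i ∨ b (suc i))
  +-+-comm : ∀ a b c d → a + b + (c + d) ≡ a + c + (b + d)
  +-+-comm = solve-∀
  twice : ∀ x y → b2n x + b2n x * b2n (not y) + (b2n y + b2n y * b2n (not x)) ≡ b2n (x ∨ y) + b2n (x ∨ y)
  twice true  true  = refl
  twice true  false = refl
  twice false true  = refl
  twice false false = refl

steady-path : ∀ m b → pathCut m b ≡ 0 → ∀ i → i ≤ m → b i ≡ b m
steady-path m b noPathCut i i≤m = walk i (m ∸ i) (m+[n∸m]≡n i≤m)
  where
  step : ∀ j → j < m → b j ≡ b (suc j)
  step j j<m = sameEnds (b j) (b (suc j))
    (∑≡0⇒ m _ (m+n≡0⇒m≡0 _ noPathCut) j j<m) (∑≡0⇒ m _ (m+n≡0⇒n≡0 _ noPathCut) j j<m)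
    where
    sameEnds : ∀ x y → b2n x * b2n (not y) ≡ 0 → b2n y * b2n (not x) ≡ 0 → x ≡ y
    sameEnds true  true  _ _ = refl
    sameEnds false false _ _ = refl
  walk : ∀ j k → j + k ≡ m → b j ≡ b m
  walk j zero    e = cong b (trans (sym (+-identityʳ j)) e)
  walk j (suc k) e = trans (step j (≤-trans (s≤s (m≤m+n j k)) (≤-reflexive e′))) (walk (suc j) k e′)
    where e′ = trans (sym (+-suc j k)) e

steady-everywhere : ∀ p m b b₀ → pathCut m b ≡ 0 → (∀ k → k < suc p → b (m + k) ≡ b₀) →
  ∀ i → i < m + suc p → b i ≡ b₀
steady-everywhere p m b b₀ noPathCut onClique i i<N with i <? m
... | yes i<m = trans (steady-path m b noPathCut i (<⇒≤ i<m))
                      (trans (cong b (sym (+-identityʳ m))) (onClique 0 (s≤s z≤n)))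
... | no  i≮m = trans (cong b (sym i≡m+k))
  (onClique (i ∸ m) (+-cancelˡ-< m _ _ (subst (_< m + suc p) (sym i≡m+k) i<N)))
  where i≡m+k = m+[n∸m]≡n (≮⇒≥ i≮m)

-- If no edge leaves S then S is all or nothing, since one of S, V∖S contains
-- no clique vertex.
no-cut⇒constant : ∀ p m b →
  pathCut m b + cliqueCount m (suc p) b * cliqueCount m (suc p) (complᵇ b) ≡ 0 →
  ∃ λ b₀ → ∀ i → i < m + suc p → b i ≡ b₀
no-cut⇒constant p m b total
  with m*n≡0⇒m≡0∨n≡0 (cliqueCount m (suc p) b) (m+n≡0⇒n≡0 (pathCut m b) total)
... | inj₁ noneIn  = false , steady-everywhere p m b false noPathCut onlyFalse
  where
  noPathCut = m+n≡0⇒m≡0 (pathCut m b) total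
  onlyFalse : ∀ k → k < suc p → b (m + k) ≡ false
  onlyFalse k k<n with b (m + k) | ∑≡0⇒ (suc p) (λ k → b2n (b (m + k))) noneIn k k<n
  ... | false | _ = refl
... | inj₂ noneOut = true , steady-everywhere p m b true noPathCut onlyTrue
  where
  noPathCut = m+n≡0⇒m≡0 (pathCut m b) total
  onlyTrue : ∀ k → k < suc p → b (m + k) ≡ true
  onlyTrue k k<n with b (m + k) | ∑≡0⇒ (suc p) (λ k → b2n (not (b (m + k)))) noneOut k k<n
  ... | true | _ = refl

-- The lollipop graph is connected: a set containing some vertex but not all
-- of them is left by at least one edge.
cut-positive : ∀ p m b →
  (∃ λ i → i < m + suc p × b i ≡ true) → (∃ λ i → i < m + suc p × b i ≡ false) →
  1 ≤ pathCut m b + cliqueCount m (suc p) b * cliqueCount m (suc p) (complᵇ b)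
cut-positive p m b (i₁ , i₁<N , bi₁) (i₂ , i₂<N , bi₂) = n≢0⇒n>0 λ total →
  let (b₀ , const) = no-cut⇒constant p m b total
  in true≢false (trans (trans (sym bi₁) (const i₁ i₁<N)) (trans (sym (const i₂ i₂<N)) bi₂))
  where
  true≢false : true ≡ false → ⊥
  true≢false ()

-- The shape of a cut of LP_{3+q,m}

-- Write p = 2 + q for the degree of a clique vertex inside the clique and
-- (2 + q) * (3 + q) = n(n-1) for the volume of the clique.  A proper set S
-- with c = cut(S, V∖S), v = vol S and v′ = vol (V∖S) has one of three shapes.
data Shape (q m c v v′ : ℕ) : Set where
  -- S and V∖S contain 1 + a and 1 + b clique vertices; at least
  -- (1 + a)(1 + b) clique edges are cut
  cliqueSplit : ∀ R R′ a b → R + R′ ≡ m + m → a + b + 1 ≡ 2 + q → (1 + a) * (1 + b) ≤ c →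
    v * v′ ≡ (R + (1 + a) * (2 + q)) * (R′ + (1 + b) * (2 + q)) → Shape q m c v v′
  -- the clique lies on one side and at least two path steps are cut
  severalSteps : ∀ x y → x + y ≡ m + m → 2 ≤ c →
    v * v′ ≡ x * (y + (2 + q) * (3 + q)) → Shape q m c v v′
  -- the clique lies on one side and a single path step is cut: one side is
  -- x_1, …, x_{r+1}, the other has k further path vertices and the clique
  oneStep : ∀ r k → m ≡ 1 + r + k → c ≡ 1 →
    v * v′ ≡ (2 * r + 1) * (2 * k + 1 + (2 + q) * (3 + q)) → Shape q m c v v′

odd-split : ∀ R R′ m E → R + R′ ≡ m + m → R + 1 ≡ E + E →
  Σ ℕ λ r → Σ ℕ λ k → (m ≡ 1 + r + k) × (R ≡ 2 * r + 1) × (R′ ≡ 2 * k + 1)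
odd-split R R′ m zero    eR eE = ⊥-elim (1+n≢0 (trans (+-comm 1 R) eE))
odd-split R R′ m (suc r) eR eE = r , m ∸ suc r , sym (m+[n∸m]≡n r<m) , R≡ , R′≡
  where
  R≡ : R ≡ 2 * r + 1
  R≡ = +-cancelʳ-≡ 1 R (2 * r + 1) (trans eE (odd r))
    where
    odd : ∀ r → suc r + suc r ≡ 2 * r + 1 + 1
    odd = solve-∀
  r<m : r < m
  r<m = *-cancelˡ-< 2 r m (begin-strict
      2 * r      <⟨ m<m+n (2 * r) (s≤s z≤n) ⟩
      2 * r + 1  ≡⟨ sym R≡ ⟩
      R          ≤⟨ m≤m+n R R′ ⟩
      R + R′     ≡⟨ eR ⟩
      m + m      ≡⟨ cong (m +_) (sym (+-identityʳ m)) ⟩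
      2 * m      ∎)
    where open ≤-Reasoning
  R′≡ : R′ ≡ 2 * (m ∸ suc r) + 1
  R′≡ = +-cancelˡ-≡ (2 * r + 1) R′ _ (trans (cong (_+ R′) (sym R≡))
          (trans eR (trans (cong₂ _+_ m≡ m≡) (double r (m ∸ suc r)))))
    where
    m≡ = sym (m+[n∸m]≡n r<m)
    double : ∀ r k → (1 + r + k) + (1 + r + k) ≡ (2 * r + 1) + (2 * k + 1)
    double = solve-∀

-- Reading off the shape from the counts: R, R′ path ends and s, s′ clique
-- vertices on the two sides, T cut path steps.  If the clique is on one side
-- the cut consists of path steps only; a single cut step makes R odd.
classify : ∀ q m c v v′ R R′ s s′ T E →
  v ≡ R + s * (2 + q) → v′ ≡ R′ + s′ * (2 + q) → c ≡ T + s * s′ →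
  R + R′ ≡ m + m → s + s′ ≡ 3 + q → R + T ≡ E + E → 1 ≤ c → Shape q m c v v′
classify q m c v v′ R R′ zero s′ T E refl refl refl eR refl eE c≥1 with T
... | zero = ⊥-elim (<-irrefl refl c≥1)
... | suc zero with odd-split R R′ m E eR eE
...   | r , k , em , refl , refl = oneStep r k em refl (cliqueRight (2 * r + 1) (2 * k + 1) q)
  where
  cliqueRight : ∀ R R′ q → (R + 0 * (2 + q)) * (R′ + (3 + q) * (2 + q)) ≡ R * (R′ + (2 + q) * (3 + q))
  cliqueRight = solve-∀
classify q m c v v′ R R′ zero s′ T E refl refl refl eR refl eE c≥1 | suc (suc _) =
  severalSteps R R′ eR (s≤s (s≤s z≤n)) (cliqueRight R R′ q)
  where
  cliqueRight : ∀ R R′ q → (R + 0 * (2 + q)) * (R′ + (3 + q) * (2 + q)) ≡ R * (R′ + (2 + q) * (3 + q))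
  cliqueRight = solve-∀
classify q m c v v′ R R′ (suc a) zero T E refl refl refl eR es eE c≥1
  with T | suc-injective (trans (sym (+-identityʳ (suc a))) es)
... | zero | _ = ⊥-elim (<-irrefl refl (subst (1 ≤_) (*-zeroʳ (suc a)) c≥1))
... | suc zero | refl with odd-split R R′ m E eR eE
...   | r , k , em , refl , refl =
  oneStep k r (trans em (cong suc (+-comm r k))) (cong suc (*-zeroʳ q)) (cliqueLeft (2 * r + 1) (2 * k + 1) q)
  where
  cliqueLeft : ∀ R R′ q → (R + (3 + q) * (2 + q)) * (R′ + 0 * (2 + q)) ≡ R′ * (R + (2 + q) * (3 + q))
  cliqueLeft = solve-∀
classify q m c v v′ R R′ (suc a) zero T E refl refl refl eR es eE c≥1 | suc (suc T′) | refl =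
  severalSteps R′ R (trans (+-comm R′ R) eR) two≤c (cliqueLeft R R′ q)
  where
  cliqueLeft : ∀ R R′ q → (R + (3 + q) * (2 + q)) * (R′ + 0 * (2 + q)) ≡ R′ * (R + (2 + q) * (3 + q))
  cliqueLeft = solve-∀
  two≤c : 2 ≤ suc (suc T′) + suc a * 0
  two≤c = subst (2 ≤_) (sym (trans (cong (suc (suc T′) +_) (*-zeroʳ (suc a))) (+-identityʳ _)))
                (s≤s (s≤s z≤n))
classify q m c v v′ R R′ (suc a) (suc b) T E refl refl refl eR es eE c≥1 =
  cliqueSplit R R′ a b eR (suc-injective (trans (sym (sizes a b)) es)) (m≤n+m _ T) refl
  where
  sizes : ∀ a b → suc a + suc b ≡ suc (a + b + 1)
  sizes = solve-∀

module Counts (p m : ℕ) (S : Subset (suc p) m) where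
  b : ℕ → Bool
  b = onℕ (m + suc p) S

  b-spec : ∀ u → S u ≡ b (toℕ u)
  b-spec u = sym (onℕ-toℕ (m + suc p) S u)

  R R′ s s′ T : ℕ
  R  = pathEnds m b
  R′ = pathEnds m (complᵇ b)
  s  = cliqueCount m (suc p) b
  s′ = cliqueCount m (suc p) (complᵇ b)
  T  = pathCut m b

  vol≡ : vol (suc p) m S ≡ R + s * p
  vol≡ = vol-counts p m S b b-spec

  volᶜ≡ : vol (suc p) m (compl (suc p) m S) ≡ R′ + s′ * p
  volᶜ≡ = vol-counts p m (compl (suc p) m S) (complᵇ b) (λ u → cong not (b-spec u))

  cut≡ : cut (suc p) m S (compl (suc p) m S) ≡ T + s * s′
  cut≡ = cut-counts p m S b b-spec

  cut≥1 : Proper (suc p) m S → 1 ≤ T + s * s′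
  cut≥1 ((u₁ , e₁) , (u₂ , e₂)) = cut-positive p m b
    (toℕ u₁ , toℕ<n u₁ , trans (sym (b-spec u₁)) e₁)
    (toℕ u₂ , toℕ<n u₂ , trans (sym (b-spec u₂)) e₂)

-- The total volume is twice the number of edges: 2m for the path steps and
-- n(n-1) for the clique.
vol-total : ∀ p m (S : Subset (suc p) m) →
  vol (suc p) m S + vol (suc p) m (compl (suc p) m S) ≡ (m + m) + suc p * p
vol-total p m S = begin
    vol (suc p) m S + vol (suc p) m (compl (suc p) m S)
  ≡⟨ cong₂ _+_ vol≡ volᶜ≡ ⟩
    R + s * p + (R′ + s′ * p)
  ≡⟨ regroup R s R′ s′ p ⟩
    (R + R′) + (s + s′) * p
  ≡⟨ cong₂ (λ x y → x + y * p) (pathEnds-compl m b) (cliqueCount-compl m (suc p) b) ⟩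
    (m + m) + suc p * p
  ∎
  where
  open ≡-Reasoning
  open Counts p m S
  regroup : ∀ R s R′ s′ p → R + s * p + (R′ + s′ * p) ≡ (R + R′) + (s + s′) * p
  regroup = solve-∀

-- Both sides of a proper cut have positive volume: a side without clique
-- vertices still contains an endpoint of a cut path step.
vol-positive : ∀ p m (S : Subset (suc p) m) → 1 ≤ p → Proper (suc p) m S →
  1 ≤ vol (suc p) m S × 1 ≤ vol (suc p) m (compl (suc p) m S)
vol-positive p m S p≥1 proper =
  subst (1 ≤_) (sym vol≡)  (side R s T s′ (pathCut≤pathEnds m b) (cut≥1 proper)) ,
  subst (1 ≤_) (sym volᶜ≡) (side R′ s′ T s (pathCut≤pathEnds-compl m b)
                              (subst (λ z → 1 ≤ T + z) (*-comm s s′) (cut≥1 proper)))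
  where
  open Counts p m S
  side : ∀ R s T s′ → T ≤ R → 1 ≤ T + s * s′ → 1 ≤ R + s * p
  side R zero    T s′ T≤R c≥1 = ≤-trans (subst (1 ≤_) (+-identityʳ T) c≥1) (≤-trans T≤R (m≤m+n R 0))
  side R (suc a) T s′ T≤R c≥1 = ≤-trans p≥1 (≤-trans (m≤m+n p (a * p)) (m≤n+m _ R))

cut-nonempty : ∀ p m (S : Subset (suc p) m) → Proper (suc p) m S → 1 ≤ cut (suc p) m S (compl (suc p) m S)
cut-nonempty p m S proper = subst (1 ≤_) (sym cut≡) (cut≥1 proper)
  where open Counts p m S

cut-shape : ∀ q m (S : Subset (3 + q) m) → Proper (3 + q) m S →
  Shape q m (cut (3 + q) m S (compl (3 + q) m S)) (vol (3 + q) m S) (vol (3 + q) m (compl (3 + q) m S))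
cut-shape q m S proper =
  classify q m _ _ _ R R′ s s′ T (proj₁ (pathEnds+pathCut-even m b))
    vol≡ volᶜ≡ cut≡ (pathEnds-compl m b) (cliqueCount-compl m (3 + q) b)
    (proj₂ (pathEnds+pathCut-even m b)) (cut-nonempty (2 + q) m S proper)
  where open Counts (2 + q) m S

-- Ncut(S, V∖S) = c (1/v + 1/v′) = c (v + v′) / (v v′).  Comparing it with
-- P / Q therefore amounts to comparing the naturals P v v′ and c (v + v′) Q.
frac-ᵘ : ∀ P q → toℚᵘ (frac P (suc q)) ℚᵘ.≃ mkℚᵘ (ℤ.+ P) q
frac-ᵘ P q = ℚP.toℚᵘ-fromℚᵘ (mkℚᵘ (ℤ.+ P) q)

Ncut-ᵘ : ∀ c a b → toℚᵘ (frac c 1 ℚ.* (inv (suc a) ℚ.+ inv (suc b)))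
  ℚᵘ.≃ mkℚᵘ (ℤ.+ (c * (suc a + suc b))) (pred (suc a * suc b))
Ncut-ᵘ c a b =
  ℚᵘP.≃-trans (ℚP.toℚᵘ-homo-* (frac c 1) (inv (suc a) ℚ.+ inv (suc b)))
    (ℚᵘP.≃-trans (ℚᵘP.*-cong (frac-ᵘ c 0)
                   (ℚᵘP.≃-trans (ℚP.toℚᵘ-homo-+ (inv (suc a)) (inv (suc b)))
                                (ℚᵘP.+-cong (frac-ᵘ 1 a) (frac-ᵘ 1 b))))
                 (*≡* cross))
  where
  x y : ℕ
  x = suc a
  y = suc b
  cross : (ℤ.+ c) ℤ.* ((ℤ.+ 1) ℤ.* (ℤ.+ y) ℤ.+ (ℤ.+ 1) ℤ.* (ℤ.+ x)) ℤ.* (ℤ.+ (x * y))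
        ≡ (ℤ.+ (c * (x + y))) ℤ.* ((ℤ.+ 1) ℤ.* (ℤ.+ (x * y)))
  cross = begin
      (ℤ.+ c) ℤ.* ((ℤ.+ 1) ℤ.* (ℤ.+ y) ℤ.+ (ℤ.+ 1) ℤ.* (ℤ.+ x)) ℤ.* (ℤ.+ (x * y))
    ≡⟨ cong (λ z → (ℤ.+ c) ℤ.* z ℤ.* (ℤ.+ (x * y)))
            (cong₂ (λ u w → ℤ.+ u ℤ.+ ℤ.+ w) (*-identityˡ y) (*-identityˡ x)) ⟩
      (ℤ.+ c) ℤ.* (ℤ.+ (y + x)) ℤ.* (ℤ.+ (x * y))
    ≡⟨ cong (ℤ._* (ℤ.+ (x * y))) (sym (pos-* c (y + x))) ⟩
      ℤ.+ (c * (y + x)) ℤ.* (ℤ.+ (x * y))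
    ≡⟨ sym (pos-* (c * (y + x)) (x * y)) ⟩
      ℤ.+ (c * (y + x) * (x * y))
    ≡⟨ cong ℤ.+_ (rearrange c x y) ⟩
      ℤ.+ (c * (x + y) * (1 * (x * y)))
    ≡⟨ pos-* (c * (x + y)) (1 * (x * y)) ⟩
      (ℤ.+ (c * (x + y))) ℤ.* (ℤ.+ (1 * (x * y)))
    ∎
    where
    open ≡-Reasoning
    rearrange : ∀ c x y → c * (y + x) * (x * y) ≡ c * (x + y) * (1 * (x * y))
    rearrange = solve-∀

frac≤Ncut : ∀ P Q c v v′ → 1 ≤ Q → 1 ≤ v → 1 ≤ v′ → P * (v * v′) ≤ c * (v + v′) * Q →
  frac P Q ℚ.≤ frac c 1 ℚ.* (inv v ℚ.+ inv v′)
frac≤Ncut P (suc q) c (suc a) (suc b) _ _ _ le =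
  ℚP.toℚᵘ-cancel-≤ (ℚᵘP.≤-respʳ-≃ (ℚᵘP.≃-sym (Ncut-ᵘ c a b))
    (ℚᵘP.≤-respˡ-≃ (ℚᵘP.≃-sym (frac-ᵘ P q))
      (*≤* (subst₂ ℤ._≤_ (pos-* P (suc a * suc b)) (pos-* (c * (suc a + suc b)) (suc q)) (ℤ.+≤+ le)))))

Ncut≡frac : ∀ P Q c v v′ → 1 ≤ Q → 1 ≤ v → 1 ≤ v′ → c * (v + v′) * Q ≡ P * (v * v′) →
  frac c 1 ℚ.* (inv v ℚ.+ inv v′) ≡ frac P Q
Ncut≡frac P (suc q) c (suc a) (suc b) _ _ _ eq =
  ℚP.toℚᵘ-injective (ℚᵘP.≃-trans (Ncut-ᵘ c a b) (ℚᵘP.≃-trans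
    (*≡* (trans (sym (pos-* (c * (suc a + suc b)) (suc q))) (trans (cong ℤ.+_ eq) (pos-* P (suc a * suc b)))))
    (ℚᵘP.≃-sym (frac-ᵘ P q))))

-- "Ncut(S, V∖S) ≥ P / Q" and "Ncut(S, V∖S) = P / Q", cleared of denominators.
NcutAtLeast NcutEquals : (n m P Q : ℕ) → Subset n m → Set
NcutAtLeast n m P Q S =
  P * (vol n m S * vol n m (compl n m S)) ≤ cut n m S (compl n m S) * (vol n m S + vol n m (compl n m S)) * Q
NcutEquals n m P Q S =
  cut n m S (compl n m S) * (vol n m S + vol n m (compl n m S)) * Q ≡ P * (vol n m S * vol n m (compl n m S))

IsMcut-intro : ∀ p m P Q → 1 ≤ p → 1 ≤ Q →
  ((S : Subset (suc p) m) → Proper (suc p) m S → NcutAtLeast (suc p) m P Q S) →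
  (Σ (Subset (suc p) m) λ S → Proper (suc p) m S × NcutEquals (suc p) m P Q S) →
  IsMcut (suc p) m (frac P Q)
IsMcut-intro p m P Q p≥1 Q≥1 lower (S₀ , proper₀ , attained) =
  (S₀ , proper₀ , Ncut≡frac P Q (c S₀) (v S₀) (vᶜ S₀) Q≥1 v₀≥1 vᶜ₀≥1 attained) ,
  λ S proper → let (v≥1 , vᶜ≥1) = vol-positive p m S p≥1 proper
               in frac≤Ncut P Q (c S) (v S) (vᶜ S) Q≥1 v≥1 vᶜ≥1 (lower S proper)
  where
  c v vᶜ : Subset (suc p) m → ℕ
  c  S = cut (suc p) m S (compl (suc p) m S)
  v  S = vol (suc p) m S
  vᶜ S = vol (suc p) m (compl (suc p) m S)
  v₀≥1 = proj₁ (vol-positive p m S₀ p≥1 proper₀)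
  vᶜ₀≥1 = proj₂ (vol-positive p m S₀ p≥1 proper₀)

-- Attaining P / Q: the complementary volume is W - v₀, so it is enough to
-- know the cut and one volume.
attains : ∀ p m (S : Subset (suc p) m) P Q c₀ v₀ v₁ →
  cut (suc p) m S (compl (suc p) m S) ≡ c₀ → vol (suc p) m S ≡ v₀ →
  v₀ + v₁ ≡ (m + m) + suc p * p → c₀ * (v₀ + v₁) * Q ≡ P * (v₀ * v₁) →
  NcutEquals (suc p) m P Q S
attains p m S P Q c₀ v₀ v₁ c≡ v≡ total identity = begin
    cut (suc p) m S (compl (suc p) m S) * (vol (suc p) m S + vol (suc p) m (compl (suc p) m S)) * Q
  ≡⟨ cong₂ (λ x y → x * y * Q) c≡ (cong₂ _+_ v≡ vᶜ≡) ⟩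
    c₀ * (v₀ + v₁) * Q
  ≡⟨ identity ⟩
    P * (v₀ * v₁)
  ≡⟨ cong (P *_) (sym (cong₂ _*_ v≡ vᶜ≡)) ⟩
    P * (vol (suc p) m S * vol (suc p) m (compl (suc p) m S))
  ∎
  where
  open ≡-Reasoning
  vᶜ≡ : vol (suc p) m (compl (suc p) m S) ≡ v₁
  vᶜ≡ = +-cancelˡ-≡ v₀ _ v₁ (trans (cong (_+ _) (sym v≡)) (trans (vol-total p m S) (sym total)))

-- Since W = v + v′ is the same for all cuts, a bound K W / Q ≤ Ncut follows
-- from K v v′ ≤ c Q.
via-total : ∀ P Q K c v v′ → P ≡ K * (v + v′) → K * (v * v′) ≤ c * Q →
  P * (v * v′) ≤ c * (v + v′) * Q
via-total P Q K c v v′ refl le = subst₂ _≤_ (swap K (v + v′) (v * v′)) (swap c (v + v′) Q)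
  (*-monoʳ-≤ (v + v′) le)
  where
  swap : ∀ x y z → y * (x * z) ≡ x * y * z
  swap = solve-∀

lower-bound : ∀ q m K P Q → P ≡ K * ((m + m) + (3 + q) * (2 + q)) →
  (∀ c v v′ → v + v′ ≡ (m + m) + (3 + q) * (2 + q) → Shape q m c v v′ → K * (v * v′) ≤ c * Q) →
  ∀ S → Proper (3 + q) m S → NcutAtLeast (3 + q) m P Q S
lower-bound q m K P Q P≡ bound S proper =
  via-total P Q K c v vᶜ (trans P≡ (cong (K *_) (sym (vol-total (2 + q) m S))))
    (bound c v vᶜ (vol-total (2 + q) m S) (cut-shape q m S proper))
  where
  c v vᶜ : ℕ
  c  = cut (3 + q) m S (compl (3 + q) m S)
  v  = vol (3 + q) m S
  vᶜ = vol (3 + q) m (compl (3 + q) m S)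

-- Initial segments: the optimal cuts

-- The first k vertices x_1, x_2, … (followed by y_1, y_2, … if k > m).
initial : (n m k : ℕ) → Subset n m
initial n m k u = toℕ u <ᵇ k

count-below : ∀ N k → k ≤ N → ∑ N (λ i → b2n (i <ᵇ k)) ≡ k
count-below N k k≤N = begin
    ∑ N (λ i → b2n (i <ᵇ k))
  ≡⟨ cong (λ z → ∑ z (λ i → b2n (i <ᵇ k))) (sym (m+[n∸m]≡n k≤N)) ⟩
    ∑ (k + (N ∸ k)) (λ i → b2n (i <ᵇ k))
  ≡⟨ ∑-split k (N ∸ k) _ ⟩
    ∑ k (λ i → b2n (i <ᵇ k)) + ∑ (N ∸ k) (λ i → b2n (k + i <ᵇ k))
  ≡⟨ cong₂ _+_ (trans (∑-cong k (λ i i<k → cong b2n (<ᵇ-true i<k))) (trans (∑-const k 1) (*-identityʳ k)))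
               (trans (∑-ext (N ∸ k) (λ i → cong b2n (+<ᵇ-false k i))) (∑-zero (N ∸ k))) ⟩
    k + 0
  ≡⟨ +-identityʳ k ⟩
    k
  ∎
  where open ≡-Reasoning

path-prefix : ∀ p m k → k < m →
  Proper (suc p) m (initial (suc p) m (suc k))
  × (vol (suc p) m (initial (suc p) m (suc k)) ≡ suc (k + k))
  × (cut (suc p) m (initial (suc p) m (suc k)) (compl (suc p) m (initial (suc p) m (suc k))) ≡ 1)
path-prefix p m k k<m =
  ((fromℕ< 0<N , cong (_<ᵇ suc k) (toℕ-fromℕ< 0<N)) ,
   (fromℕ< m<N , trans (cong (_<ᵇ suc k) (toℕ-fromℕ< m<N)) (<ᵇ-false k<m))) ,
  trans vol≡ (trans (cong₂ (λ x y → x + y * p) R≡ s≡0) (+-identityʳ _)) ,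
  trans cut≡ (cong₂ (λ x y → x + y * s′) T≡1 s≡0)
  where
  open Counts p m (initial (suc p) m (suc k))
  N = m + suc p
  m<N : m < N
  m<N = subst (m <_) (sym (+-suc m p)) (s≤s (m≤m+n m p))
  0<N : 0 < N
  0<N = ≤-<-trans z≤n m<N
  b≡ : ∀ i → i < N → b i ≡ (i <ᵇ suc k)
  b≡ i i<N = onℕ-index N (_<ᵇ suc k) i i<N
  onPath : ∀ {i} → i < m → i < N
  onPath i<m = <-≤-trans i<m (<⇒≤ m<N)
  R≡ : R ≡ suc (k + k)
  R≡ = cong₂ _+_
    (trans (∑-cong m (λ i i<m → cong b2n (b≡ i (onPath i<m)))) (count-below m (suc k) k<m))
    (trans (∑-cong m (λ i i<m → cong b2n (b≡ (suc i) (≤-<-trans i<m m<N)))) (count-below m k (<⇒≤ k<m)))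
  s≡0 : s ≡ 0
  s≡0 = trans (∑-cong (suc p) (λ j j<n → cong b2n (trans (b≡ (m + j) (+-monoʳ-< m j<n))
                                                          (<ᵇ-false (≤-trans k<m (m≤m+n m j))))))
              (∑-zero (suc p))
  T≡1 : T ≡ 1
  T≡1 = cong₂ _+_
    (trans (∑-cong m (λ i i<m → trans (cong₂ (λ x y → b2n x * b2n (not y))
                                               (b≡ i (onPath i<m)) (b≡ (suc i) (≤-<-trans i<m m<N)))
                                      (leaving i k)))
           (∑-point m k (λ _ → 1) k<m))
    (trans (∑-cong m (λ i i<m → trans (cong₂ (λ x y → b2n x * b2n (not y))
                                               (b≡ (suc i) (≤-<-trans i<m m<N)) (b≡ i (onPath i<m)))
                                      (entering i k)))
           (∑-zero m))
    where
    leaving : ∀ i k → b2n (i <ᵇ suc k) * b2n (not (i <ᵇ k)) ≡ b2n (k ≡ᵇ i) * 1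
    leaving zero    zero    = refl
    leaving zero    (suc k) = refl
    leaving (suc i) zero    = refl
    leaving (suc i) (suc k) = leaving i k
    entering : ∀ i k → b2n (i <ᵇ k) * b2n (not (i <ᵇ suc k)) ≡ 0
    entering zero    zero    = refl
    entering zero    (suc k) = refl
    entering (suc i) zero    = refl
    entering (suc i) (suc k) = entering i k

+<ᵇ+ : ∀ m a b → (m + a <ᵇ m + b) ≡ (a <ᵇ b)
+<ᵇ+ zero    a b = refl
+<ᵇ+ (suc m) a b = +<ᵇ+ m a b

-- The whole path together with y_1 has volume 2m + p and is left by the p
-- clique edges at y_1.
path-and-y₁ : ∀ p m → 1 ≤ p →
  Proper (suc p) m (initial (suc p) m (suc m))
  × (vol (suc p) m (initial (suc p) m (suc m)) ≡ (m + m) + p)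
  × (cut (suc p) m (initial (suc p) m (suc m)) (compl (suc p) m (initial (suc p) m (suc m))) ≡ p)
path-and-y₁ p m p≥1 =
  ((fromℕ< 0<N , cong (_<ᵇ suc m) (toℕ-fromℕ< 0<N)) ,
   (fromℕ< m+1<N , trans (cong (_<ᵇ suc m) (toℕ-fromℕ< m+1<N)) (<ᵇ-false (≤-refl {suc m})))) ,
  trans vol≡ (cong₂ (λ x y → x + y * p) R≡ s≡1 ⟨trans⟩ cong ((m + m) +_) (+-identityʳ p)) ,
  trans cut≡ (trans (cong₂ (λ x y → x + y * s′) T≡0 s≡1) (trans (+-identityʳ s′) s′≡p))
  where
  open Counts p m (initial (suc p) m (suc m))
  _⟨trans⟩_ = trans
  N = m + suc p
  m+1<N : suc m < N
  m+1<N = subst (suc m <_) (sym (+-suc m p)) (s≤s (subst (_≤ m + p) (+-comm m 1) (+-monoʳ-≤ m p≥1)))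
  0<N : 0 < N
  0<N = ≤-<-trans z≤n m+1<N
  b≡ : ∀ i → i < N → b i ≡ (i <ᵇ suc m)
  b≡ i i<N = onℕ-index N (_<ᵇ suc m) i i<N
  onPath : ∀ {i} → i < m → suc i < N
  onPath i<m = <-trans (s≤s i<m) m+1<N
  R≡ : R ≡ m + m
  R≡ = cong₂ _+_
    (trans (∑-cong m (λ i i<m → cong b2n (trans (b≡ i (<-trans (n<1+n i) (onPath i<m)))
                                                 (<ᵇ-true (<-trans i<m (n<1+n m))))))
           (trans (∑-const m 1) (*-identityʳ m)))
    (trans (∑-cong m (λ i i<m → cong b2n (b≡ (suc i) (onPath i<m)))) (count-below m m ≤-refl))
  s≡1 : s ≡ 1
  s≡1 = trans (∑-cong (suc p) (λ j j<n → cong b2n (trans (b≡ (m + j) (+-monoʳ-< m j<n))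
                                                  (trans (cong (m + j <ᵇ_) (sym (+-comm m 1))) (+<ᵇ+ m j 1)))))
              (count-below (suc p) 1 (s≤s z≤n))
  s′≡p : s′ ≡ p
  s′≡p = suc-injective (trans (sym (cong (_+ s′) s≡1)) (cliqueCount-compl m (suc p) b))
  -- the complement has no path ends, so no path step is cut
  T≡0 : T ≡ 0
  T≡0 = n≤0⇒n≡0 (subst (T ≤_) (+-cancelˡ-≡ (m + m) R′ 0 (trans (cong (_+ R′) (sym R≡))
          (trans (pathEnds-compl m b) (sym (+-identityʳ (m + m)))))) (pathCut≤pathEnds-compl m b))

am-gm : ∀ x y → 4 * (x * y) ≤ (x + y) * (x + y)
am-gm x y = [ ordered x y
            , (λ y≤x → subst₂ (λ a b → 4 * a ≤ b * b) (*-comm y x) (+-comm y x) (ordered y x y≤x))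
            ]′ (≤-total x y)
  where
  -- with y = x + d: (2x + d)² = 4 x (x + d) + d²
  ordered : ∀ x y → x ≤ y → 4 * (x * y) ≤ (x + y) * (x + y)
  ordered x y x≤y = subst (λ z → 4 * (x * z) ≤ (x + z) * (x + z)) (m+[n∸m]≡n x≤y)
    (subst (4 * (x * (x + (y ∸ x))) ≤_) (sym (square x (y ∸ x))) (m≤m+n _ _))
    where
    square : ∀ x d → (x + (x + d)) * (x + (x + d)) ≡ 4 * (x * (x + d)) + d * d
    square = solve-∀

am-gm-half : ∀ x y m → x + y ≡ m + m → x * y ≤ m * m
am-gm-half x y m e = *-cancelˡ-≤ 4
  (subst (4 * (x * y) ≤_) (quadruple m) (subst (λ z → 4 * (x * y) ≤ z * z) e (am-gm x y)))
  where
  quadruple : ∀ m → (m + m) * (m + m) ≡ 4 * (m * m)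
  quadruple = solve-∀

product≥sum : ∀ a b → a + b + 1 ≤ (1 + a) * (1 + b)
product≥sum a b = subst (a + b + 1 ≤_) (sym (expand a b)) (m≤m+n (a + b + 1) (a * b))
  where
  expand : ∀ a b → (1 + a) * (1 + b) ≡ (a + b + 1) + a * b
  expand = solve-∀

-- Case 2 ≤ m ≤ (n(n-1) + 4)/2: every cut has v v′ ≤ c (2m - 1)(n(n-1) + 1)

-- Below m = 2 + t, A = n(n-1) = (2 + q)(3 + q) and D = (2m - 1)(A + 1).

-- Split clique: c ≥ X = (1 + a)(1 + b) ≥ p = 2 + q.  Expanding v v′, the path
-- part is at most m² (AM-GM) and the mixed part at most 2 m p X.
split-bound₁ : ∀ t q R R′ a b c → R + R′ ≡ (2 + t) + (2 + t) → a + b + 1 ≡ 2 + q →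
  (1 + a) * (1 + b) ≤ c → 2 * t ≤ (2 + q) * (3 + q) →
  (R + (1 + a) * (2 + q)) * (R′ + (1 + b) * (2 + q)) ≤ c * ((3 + 2 * t) * ((2 + q) * (3 + q) + 1))
split-bound₁ t q R R′ a b c eR eab X≤c 2t≤A = begin
    (R + s * p) * (R′ + s′ * p)
  ≡⟨ expand R R′ a b q ⟩
    R * R′ + p * (R * s′ + R′ * s) + p * p * X
  ≤⟨ +-monoˡ-≤ (p * p * X) (+-mono-≤ (am-gm-half R R′ m eR)
       (*-monoʳ-≤ p (+-mono-≤ (*-monoʳ-≤ R (m≤n*m s′ s)) (*-monoʳ-≤ R′ (m≤m*n s s′))))) ⟩
    m * m + p * (R * X + R′ * X) + p * p * X
  ≡⟨ cong (λ z → m * m + p * z + p * p * X) (trans (sym (*-distribʳ-+ X R R′)) (cong (_* X) eR)) ⟩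
    m * m + p * ((m + m) * X) + p * p * X
  ≤⟨ +-monoˡ-≤ (p * p * X) (+-monoˡ-≤ (p * ((m + m) * X))
       (≤-trans (m²≤pK t q 2t≤A) (*-monoˡ-≤ (K t q) p≤X))) ⟩
    X * K t q + p * ((m + m) * X) + p * p * X
  ≡⟨ collect t q X ⟩
    X * D
  ≤⟨ *-monoˡ-≤ D X≤c ⟩
    c * D
  ∎
  where
  open ≤-Reasoning
  m = 2 + t
  p = 2 + q
  s = 1 + a
  s′ = 1 + b
  X = s * s′
  D = (3 + 2 * t) * ((2 + q) * (3 + q) + 1)
  p≤X : p ≤ X
  p≤X = subst (_≤ X) eab (product≥sum a b)
  -- K = D - 2 m p - p², the room left for the path part
  K : ℕ → ℕ → ℕ
  K t q = 9 + 7 * q + 2 * (q * q) + 10 * t + 8 * (t * q) + 2 * (t * (q * q))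
  m²≤pK : ∀ t q → 2 * t ≤ (2 + q) * (3 + q) → (2 + t) * (2 + t) ≤ (2 + q) * K t q
  m²≤pK t q 2t≤A = *-cancelˡ-≤ 2 (begin
      2 * ((2 + t) * (2 + t))              ≡⟨ square t ⟩
      8 + 8 * t + 2 * t * t                ≤⟨ +-monoʳ-≤ (8 + 8 * t) (*-monoˡ-≤ t 2t≤A) ⟩
      8 + 8 * t + (2 + q) * (3 + q) * t    ≤⟨ m≤m+n _ _ ⟩
      8 + 8 * t + (2 + q) * (3 + q) * t + _ ≡⟨ sym (twice-pK t q) ⟩
      2 * ((2 + q) * K t q)                ∎)
    where
    square : ∀ t → 2 * ((2 + t) * (2 + t)) ≡ 8 + 8 * t + 2 * t * t
    square = solve-∀
    twice-pK : ∀ t q → 2 * ((2 + q) * (9 + 7 * q + 2 * (q * q) + 10 * t + 8 * (t * q) + 2 * (t * (q * q))))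
      ≡ (8 + 8 * t + (2 + q) * (3 + q) * t)
        + (28 + 46 * q + 47 * q * t + 22 * q * q + 23 * q * q * t + 4 * q * q * q + 4 * q * q * q * t + 26 * t)
    twice-pK = solve-∀
  expand : ∀ R R′ a b q → (R + (1 + a) * (2 + q)) * (R′ + (1 + b) * (2 + q))
    ≡ R * R′ + (2 + q) * (R * (1 + b) + R′ * (1 + a)) + (2 + q) * (2 + q) * ((1 + a) * (1 + b))
  expand = solve-∀
  collect : ∀ t q X → X * (9 + 7 * q + 2 * (q * q) + 10 * t + 8 * (t * q) + 2 * (t * (q * q)))
                       + (2 + q) * (((2 + t) + (2 + t)) * X) + (2 + q) * (2 + q) * X
                     ≡ X * ((3 + 2 * t) * ((2 + q) * (3 + q) + 1))
  collect = solve-∀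

-- Clique on one side, at least two steps cut: x ≤ 2m and x y ≤ m².
steps-bound₁ : ∀ t A x y c → x + y ≡ (2 + t) + (2 + t) → 2 ≤ c → 2 * t ≤ A →
  x * (y + A) ≤ c * ((3 + 2 * t) * (A + 1))
steps-bound₁ t A x y c e 2≤c 2t≤A = begin
    x * (y + A)
  ≡⟨ *-distribˡ-+ x y A ⟩
    x * y + x * A
  ≤⟨ +-mono-≤ (am-gm-half x y m e) (*-monoˡ-≤ A (subst (x ≤_) e (m≤m+n x y))) ⟩
    m * m + (m + m) * A
  ≡⟨ cong (_+ (m + m) * A) (square t) ⟩
    (4 + 4 * t + t * t) + (m + m) * A
  ≤⟨ +-monoˡ-≤ ((m + m) * A) (+-monoʳ-≤ (4 + 4 * t) (*-monoʳ-≤ t (≤-trans (m≤m+n t (t + 0)) 2t≤A))) ⟩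
    (4 + 4 * t + t * A) + (m + m) * A
  ≤⟨ m≤m+n _ _ ⟩
    (4 + 4 * t + t * A) + (m + m) * A + ((2 + t) * A + 2)
  ≡⟨ sym (twice-D t A) ⟩
    2 * D
  ≤⟨ *-monoˡ-≤ D 2≤c ⟩
    c * D
  ∎
  where
  open ≤-Reasoning
  m = 2 + t
  D = (3 + 2 * t) * (A + 1)
  square : ∀ t → (2 + t) * (2 + t) ≡ 4 + 4 * t + t * t
  square = solve-∀
  twice-D : ∀ t A → 2 * ((3 + 2 * t) * (A + 1))
                  ≡ ((4 + 4 * t + t * A) + ((2 + t) + (2 + t)) * A) + ((2 + t) * A + 2)
  twice-D = solve-∀

-- One step cut: (2a + 1)(2b + 1 + A) ≤ (2a + 2b + 1)(A + 1) when 2a + 2b ≤ A + 2;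
-- the difference is 2b (A - 2a), and 2a ≤ A unless b = 0.
oneStep-bound₁ : ∀ a b A → 2 * a + 2 * b ≤ A + 2 →
  (2 * a + 1) * (2 * b + 1 + A) ≤ (2 * a + 2 * b + 1) * (A + 1)
oneStep-bound₁ a b A h = +-cancelʳ-≤ (2 * b * A) _ _ (begin
    (2 * a + 1) * (2 * b + 1 + A) + 2 * b * A
  ≡⟨ balance a b A ⟩
    (2 * a + 2 * b + 1) * (A + 1) + 2 * b * (2 * a)
  ≤⟨ +-monoʳ-≤ ((2 * a + 2 * b + 1) * (A + 1)) (scaled b h) ⟩
    (2 * a + 2 * b + 1) * (A + 1) + 2 * b * A
  ∎)
  where
  open ≤-Reasoning
  balance : ∀ a b A → (2 * a + 1) * (2 * b + 1 + A) + 2 * b * A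
                    ≡ (2 * a + 2 * b + 1) * (A + 1) + 2 * b * (2 * a)
  balance = solve-∀
  scaled : ∀ b → 2 * a + 2 * b ≤ A + 2 → 2 * b * (2 * a) ≤ 2 * b * A
  scaled zero    _ = z≤n
  scaled (suc b) h = *-monoʳ-≤ (2 * suc b)
    (+-cancelʳ-≤ 2 (2 * a) A (≤-trans (+-monoʳ-≤ (2 * a) (*-monoʳ-≤ 2 (s≤s z≤n))) h))

bound₁ : ∀ q t c v v′ → 2 * t ≤ (2 + q) * (3 + q) → Shape q (2 + t) c v v′ →
  v * v′ ≤ c * ((3 + 2 * t) * ((2 + q) * (3 + q) + 1))
bound₁ q t c v v′ 2t≤A (cliqueSplit R R′ a b eR eab X≤c vv′≡) =
  ≤-trans (≤-reflexive vv′≡) (split-bound₁ t q R R′ a b c eR eab X≤c 2t≤A)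
bound₁ q t c v v′ 2t≤A (severalSteps x y e 2≤c vv′≡) =
  ≤-trans (≤-reflexive vv′≡) (steps-bound₁ t ((2 + q) * (3 + q)) x y c e 2≤c 2t≤A)
bound₁ q t c v v′ 2t≤A (oneStep r k m≡ refl vv′≡) =
  subst₂ _≤_ (sym vv′≡)
    (trans (cong (_* (A + 1)) (sym (lengths t r k (suc-injective m≡)))) (sym (*-identityˡ _)))
    (oneStep-bound₁ r k A (subst (_≤ A + 2) (sym (ends t r k (suc-injective m≡)))
                                   (subst (2 + 2 * t ≤_) (+-comm 2 A) (+-monoʳ-≤ 2 2t≤A))))
  where
  A = (2 + q) * (3 + q)
  lengths : ∀ t r k → 1 + t ≡ r + k → 3 + 2 * t ≡ 2 * r + 2 * k + 1
  lengths t r k e = trans (twice t) (trans (cong (λ z → 1 + 2 * z) e) (twice′ r k))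
    where
    twice : ∀ t → 3 + 2 * t ≡ 1 + 2 * (1 + t)
    twice = solve-∀
    twice′ : ∀ r k → 1 + 2 * (r + k) ≡ 2 * r + 2 * k + 1
    twice′ = solve-∀
  ends : ∀ t r k → 1 + t ≡ r + k → 2 * r + 2 * k ≡ 2 + 2 * t
  ends t r k e = trans (sym (*-distribˡ-+ 2 r k)) (trans (cong (2 *_) (sym e)) (*-distribˡ-+ 2 1 t))

clique-volume : ∀ q → (3 + q) * (3 + q) ∸ (3 + q) ≡ (2 + q) * (3 + q)
clique-volume q = m+n∸m≡n (3 + q) ((2 + q) * (3 + q))

-- The minimum of this case is attained by the whole path x_1, …, x_m, whose
-- complement is the clique: Ncut = W / ((2m - 1)(n(n-1) + 1)).
mcut₁ : ∀ q t → 2 * t ≤ (2 + q) * (3 + q) →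
  IsMcut (3 + q) (2 + t) (frac ((2 + q) * (3 + q) + 2 * (2 + t)) ((3 + 2 * t) * ((2 + q) * (3 + q) + 1)))
mcut₁ q t 2t≤A = IsMcut-intro (2 + q) m W D (s≤s z≤n) (s≤s z≤n) lower
  (path , proper , attains (2 + q) m path W D 1 (3 + 2 * t) (A + 1)
                     c≡ (trans v≡ (odd t)) (total-path t q) (ratio t q))
  where
  m = 2 + t
  A = (2 + q) * (3 + q)
  W = A + 2 * m
  D = (3 + 2 * t) * (A + 1)
  lower : ∀ S → Proper (3 + q) m S → NcutAtLeast (3 + q) m W D S
  lower = lower-bound q m 1 W D (total t q)
    (λ c v v′ _ shape → subst (_≤ c * D) (sym (*-identityˡ _)) (bound₁ q t c v v′ 2t≤A shape))
    where
    total : ∀ t q → (2 + q) * (3 + q) + 2 * (2 + t) ≡ 1 * (((2 + t) + (2 + t)) + (3 + q) * (2 + q))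
    total = solve-∀
  path = initial (3 + q) m m
  prefix = path-prefix (2 + q) m (1 + t) ≤-refl
  proper = proj₁ prefix
  v≡ = proj₁ (proj₂ prefix)
  c≡ = proj₂ (proj₂ prefix)
  odd : ∀ t → suc (suc t + suc t) ≡ 3 + 2 * t
  odd = solve-∀
  total-path : ∀ t q → 3 + 2 * t + ((2 + q) * (3 + q) + 1) ≡ ((2 + t) + (2 + t)) + (3 + q) * (2 + q)
  total-path = solve-∀
  ratio : ∀ t q → 1 * (3 + 2 * t + ((2 + q) * (3 + q) + 1)) * ((3 + 2 * t) * ((2 + q) * (3 + q) + 1))
        ≡ ((2 + q) * (3 + q) + 2 * (2 + t)) * ((3 + 2 * t) * ((2 + q) * (3 + q) + 1))
  ratio = solve-∀

-- Case m = 1: every cut has v v′ ≤ c (n + 1)(n - 1)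

-- Split clique, with R + R′ = 2 path ends and X = (1 + a)(1 + b) ≥ p:
-- v v′ = R R′ + p (R s′ + R′ s) + p² X, and the middle term is at most
-- 2 p X, with room for R R′ = 1 when R = R′ = 1.
split-bound₄ : ∀ q R R′ a b → R + R′ ≡ 2 → a + b + 1 ≡ 2 + q →
  (R + (1 + a) * (2 + q)) * (R′ + (1 + b) * (2 + q)) ≤ ((1 + a) * (1 + b)) * ((4 + q) * (2 + q))
split-bound₄ q 0 .2 a b refl eab = begin
    (0 + (1 + a) * p) * (2 + (1 + b) * p)  ≡⟨ expand a b q ⟩
    2 * ((1 + a) * p) + p * p * X
      ≤⟨ +-monoˡ-≤ (p * p * X) (*-monoʳ-≤ 2 (*-monoˡ-≤ p (m≤m*n (1 + a) (1 + b)))) ⟩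
    2 * (X * p) + p * p * X                ≡⟨ collect q X ⟩
    X * ((4 + q) * p)                      ∎
  where
  open ≤-Reasoning
  p = 2 + q
  X = (1 + a) * (1 + b)
  expand : ∀ a b q → (0 + (1 + a) * (2 + q)) * (2 + (1 + b) * (2 + q))
    ≡ 2 * ((1 + a) * (2 + q)) + (2 + q) * (2 + q) * ((1 + a) * (1 + b))
  expand = solve-∀
  collect : ∀ q X → 2 * (X * (2 + q)) + (2 + q) * (2 + q) * X ≡ X * ((4 + q) * (2 + q))
  collect = solve-∀
split-bound₄ q 2 .0 a b refl eab = begin
    (2 + (1 + a) * p) * (0 + (1 + b) * p)  ≡⟨ expand a b q ⟩
    2 * ((1 + b) * p) + p * p * X
      ≤⟨ +-monoˡ-≤ (p * p * X) (*-monoʳ-≤ 2 (*-monoˡ-≤ p (m≤n*m (1 + b) (1 + a)))) ⟩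
    2 * (X * p) + p * p * X                ≡⟨ collect q X ⟩
    X * ((4 + q) * p)                      ∎
  where
  open ≤-Reasoning
  p = 2 + q
  X = (1 + a) * (1 + b)
  expand : ∀ a b q → (2 + (1 + a) * (2 + q)) * (0 + (1 + b) * (2 + q))
    ≡ 2 * ((1 + b) * (2 + q)) + (2 + q) * (2 + q) * ((1 + a) * (1 + b))
  expand = solve-∀
  collect : ∀ q X → 2 * (X * (2 + q)) + (2 + q) * (2 + q) * X ≡ X * ((4 + q) * (2 + q))
  collect = solve-∀
split-bound₄ q 1 .1 a b refl eab = begin
    (1 + (1 + a) * p) * (1 + (1 + b) * p)  ≡⟨ expand a b q ⟩
    1 + p * (1 + (a + b + 1)) + p * p * X  ≡⟨ cong (λ z → 1 + p * (1 + z) + p * p * X) eab ⟩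
    1 + p * (1 + p) + p * p * X
      ≤⟨ +-monoˡ-≤ (p * p * X) (≤-trans (small q) (*-monoʳ-≤ 2 (*-monoʳ-≤ p p≤X))) ⟩
    2 * (p * X) + p * p * X                ≡⟨ collect q X ⟩
    X * ((4 + q) * p)                      ∎
  where
  open ≤-Reasoning
  p = 2 + q
  X = (1 + a) * (1 + b)
  p≤X : p ≤ X
  p≤X = subst (_≤ X) eab (product≥sum a b)
  expand : ∀ a b q → (1 + (1 + a) * (2 + q)) * (1 + (1 + b) * (2 + q))
    ≡ 1 + (2 + q) * (1 + (a + b + 1)) + (2 + q) * (2 + q) * ((1 + a) * (1 + b))
  expand = solve-∀
  -- 1 + p (1 + p) ≤ 2 p² as p ≥ 2
  small : ∀ q → 1 + (2 + q) * (1 + (2 + q)) ≤ 2 * ((2 + q) * (2 + q))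
  small q = subst (1 + (2 + q) * (1 + (2 + q)) ≤_) (sym (gap q)) (m≤m+n _ _)
    where
    gap : ∀ q → 2 * ((2 + q) * (2 + q)) ≡ (1 + (2 + q) * (1 + (2 + q))) + (1 + 3 * q + q * q)
    gap = solve-∀
  collect : ∀ q X → 2 * ((2 + q) * X) + (2 + q) * (2 + q) * X ≡ X * ((4 + q) * (2 + q))
  collect = solve-∀
split-bound₄ q (suc (suc (suc _))) _ a b () eab

-- Clique on one side, at least two steps cut: x y ≤ 1 and x ≤ 2.
steps-bound₄ : ∀ q x y c → x + y ≡ 2 → 2 ≤ c → x * (y + (2 + q) * (3 + q)) ≤ c * ((4 + q) * (2 + q))
steps-bound₄ q x y c e 2≤c = begin
    x * (y + A)              ≡⟨ *-distribˡ-+ x y A ⟩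
    x * y + x * A            ≤⟨ +-mono-≤ (am-gm-half x y 1 e) (*-monoˡ-≤ A (subst (x ≤_) e (m≤m+n x y))) ⟩
    1 * 1 + 2 * A            ≤⟨ m≤m+n _ _ ⟩
    1 * 1 + 2 * A + (3 + 2 * q) ≡⟨ sym (gap q) ⟩
    2 * ((4 + q) * (2 + q))  ≤⟨ *-monoˡ-≤ _ 2≤c ⟩
    c * ((4 + q) * (2 + q))  ∎
  where
  open ≤-Reasoning
  A = (2 + q) * (3 + q)
  gap : ∀ q → 2 * ((4 + q) * (2 + q)) ≡ (1 * 1 + 2 * ((2 + q) * (3 + q))) + (3 + 2 * q)
  gap = solve-∀

-- The bound of this case for every shape; with one cut step the sides are
-- x_1 and the rest.
bound₄ : ∀ q c v v′ → Shape q 1 c v v′ → v * v′ ≤ c * ((4 + q) * (2 + q))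
bound₄ q c v v′ (cliqueSplit R R′ a b eR eab X≤c vv′≡) =
  ≤-trans (≤-reflexive vv′≡)
    (≤-trans (split-bound₄ q R R′ a b eR eab) (*-monoˡ-≤ ((4 + q) * (2 + q)) X≤c))
bound₄ q c v v′ (severalSteps x y e 2≤c vv′≡) =
  ≤-trans (≤-reflexive vv′≡) (steps-bound₄ q x y c e 2≤c)
bound₄ q c v v′ (oneStep zero zero m≡ refl vv′≡) =
  ≤-trans (≤-reflexive vv′≡) (≤-trans (m≤m+n _ (1 + q)) (≤-reflexive (sym (gap q))))
  where
  gap : ∀ q → 1 * ((4 + q) * (2 + q)) ≡ (2 * 0 + 1) * (2 * 0 + 1 + (2 + q) * (3 + q)) + (1 + q)
  gap = solve-∀
bound₄ q c v v′ (oneStep zero    (suc k) () c≡ vv′≡)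
bound₄ q c v v′ (oneStep (suc r) k       () c≡ vv′≡)

-- The minimum for m = 1 is attained by {x_1, y_1}: Ncut = W / ((n + 1)(n - 1)).
mcut₄ : ∀ q → IsMcut (3 + q) 1 (frac ((2 + q) * (3 + q) + 2) ((4 + q) * (2 + q)))
mcut₄ q = IsMcut-intro (2 + q) 1 W D (s≤s z≤n) (s≤s z≤n) lower
  (S₀ , proj₁ facts , attains (2 + q) 1 S₀ W D (2 + q) (2 + (2 + q)) ((2 + q) * (2 + q))
                        (proj₂ (proj₂ facts)) (proj₁ (proj₂ facts)) (total-S₀ q) (ratio q))
  where
  W = (2 + q) * (3 + q) + 2
  D = (4 + q) * (2 + q)
  lower : ∀ S → Proper (3 + q) 1 S → NcutAtLeast (3 + q) 1 W D S
  lower = lower-bound q 1 1 W D (total q)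
    (λ c v v′ _ shape → subst (_≤ c * D) (sym (*-identityˡ _)) (bound₄ q c v v′ shape))
    where
    total : ∀ q → (2 + q) * (3 + q) + 2 ≡ 1 * ((1 + 1) + (3 + q) * (2 + q))
    total = solve-∀
  S₀ = initial (3 + q) 1 2
  facts = path-and-y₁ (2 + q) 1 (s≤s z≤n)
  total-S₀ : ∀ q → 2 + (2 + q) + (2 + q) * (2 + q) ≡ (1 + 1) + (3 + q) * (2 + q)
  total-S₀ = solve-∀
  ratio : ∀ q → (2 + q) * (2 + (2 + q) + (2 + q) * (2 + q)) * ((4 + q) * (2 + q))
        ≡ ((2 + q) * (3 + q) + 2) * ((2 + (2 + q)) * ((2 + q) * (2 + q)))
  ratio = solve-∀

-- Long paths: the balanced cut

prefix-fits : ∀ A m j → A + 4 < 2 * m → 4 * suc j ≤ A + 2 * m + 2 → suc j ≤ m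
prefix-fits A m j long fits = *-cancelˡ-≤ 4 (begin
    4 * suc j        ≤⟨ fits ⟩
    A + 2 * m + 2    ≡⟨ +-comm-middle A (2 * m) 2 ⟩
    (A + 2) + 2 * m  ≤⟨ +-monoˡ-≤ (2 * m) (≤-trans (+-monoʳ-≤ A (s≤s (s≤s z≤n))) (<⇒≤ long)) ⟩
    2 * m + 2 * m    ≡⟨ double m ⟩
    4 * m            ∎)
  where
  open ≤-Reasoning
  +-comm-middle : ∀ a b c → a + b + c ≡ (a + c) + b
  +-comm-middle = solve-∀
  double : ∀ m → 2 * m + 2 * m ≡ 4 * m
  double = solve-∀

-- If 4 divides W + 2, the prefix with volume W / 2 splits the volume evenly
-- and Ncut = 4 / W, the least value AM-GM allows.
mcut₂ : ∀ q m → 4 ∣ (2 + q) * (3 + q) + 2 * m + 2 → (2 + q) * (3 + q) + 4 < 2 * m →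
  IsMcut (3 + q) m (frac 4 ((2 + q) * (3 + q) + 2 * m))
mcut₂ q m (divides zero W+2≡0) _ = ⊥-elim (1+n≢0 (m+n≡0⇒n≡0 ((2 + q) * (3 + q) + 2 * m) W+2≡0))
mcut₂ q m (divides (suc j) W+2≡) long = IsMcut-intro (2 + q) m 4 W (s≤s z≤n) (s≤s z≤n) lower
  (S₀ , proj₁ prefix , attains (2 + q) m S₀ 4 W 1 (suc (j + j)) (suc (j + j))
                         (proj₂ (proj₂ prefix)) (proj₁ (proj₂ prefix))
                         (trans (halves j) (trans (sym W≡) (total q m))) ratio)
  where
  A = (2 + q) * (3 + q)
  W = A + 2 * m
  total : ∀ q m → (2 + q) * (3 + q) + 2 * m ≡ (m + m) + (3 + q) * (2 + q)
  total = solve-∀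
  lower : ∀ S → Proper (3 + q) m S → NcutAtLeast (3 + q) m 4 W S
  lower S proper = begin
      4 * (v * vᶜ)          ≤⟨ am-gm v vᶜ ⟩
      (v + vᶜ) * (v + vᶜ)   ≡⟨ cong ((v + vᶜ) *_) (trans (vol-total (2 + q) m S) (sym (total q m))) ⟩
      (v + vᶜ) * W          ≤⟨ *-monoˡ-≤ W (m≤n*m (v + vᶜ) c {{c≢0}}) ⟩
      c * (v + vᶜ) * W      ∎
    where
    open ≤-Reasoning
    c  = cut (3 + q) m S (compl (3 + q) m S)
    v  = vol (3 + q) m S
    vᶜ = vol (3 + q) m (compl (3 + q) m S)
    c≢0 = >-nonZero (cut-nonempty (2 + q) m S proper)
  W≡ : W ≡ 4 * j + 2
  W≡ = +-cancelʳ-≡ 2 W (4 * j + 2) (trans W+2≡ (shift j))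
    where
    shift : ∀ j → suc j * 4 ≡ 4 * j + 2 + 2
    shift = solve-∀
  S₀ = initial (3 + q) m (suc j)
  prefix = path-prefix (2 + q) m j (prefix-fits A m j long (≤-reflexive (trans (*-comm 4 (suc j)) (sym W+2≡))))
  halves : ∀ j → suc (j + j) + suc (j + j) ≡ 4 * j + 2
  halves = solve-∀
  ratio : 1 * (suc (j + j) + suc (j + j)) * W ≡ 4 * (suc (j + j) * suc (j + j))
  ratio = trans (cong (1 * (suc (j + j) + suc (j + j)) *_) W≡) (balanced j)
    where
    balanced : ∀ j → 1 * (suc (j + j) + suc (j + j)) * (4 * j + 2) ≡ 4 * (suc (j + j) * suc (j + j))
    balanced = solve-∀

consecutive-even : ∀ p → ∃ λ h → p * suc p ≡ h + h
consecutive-even zero    = 0 , refl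
consecutive-even (suc p) with consecutive-even p
... | h , e = h + suc p , trans (step p) (trans (cong (_+ (suc p + suc p)) e) (regroup h (suc p)))
  where
  step : ∀ p → suc p * suc (suc p) ≡ p * suc p + (suc p + suc p)
  step = solve-∀
  regroup : ∀ h x → h + h + (x + x) ≡ (h + x) + (h + x)
  regroup = solve-∀

halve : ∀ x → ∃ λ y → (x ≡ y + y) ⊎ (x ≡ suc (y + y))
halve zero = 0 , inj₁ refl
halve (suc x) with halve x
... | y , inj₁ e = y , inj₂ (cong suc e)
... | y , inj₂ e = suc y , inj₁ (trans (cong suc e) (cong suc (sym (+-suc y y))))

-- For distinct odd numbers (v - v′)² ≥ 4, so AM-GM improves to
-- 4 v v′ ≤ (v + v′)² - 4 = (v + v′ - 2)(v + v′ + 2).  With j = r + 1 + d the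
-- gap is 4d² + 8d.
odd-am-gm< : ∀ r j → r < j → 4 * ((2 * r + 1) * (2 * j + 1)) ≤ (2 * r + 2 * j) * ((2 * r + 2 * j) + 4)
odd-am-gm< r j r<j = subst (λ z → 4 * ((2 * r + 1) * (2 * z + 1)) ≤ (2 * r + 2 * z) * ((2 * r + 2 * z) + 4))
  (trans (cong (_+ (j ∸ suc r)) (+-comm r 1)) (m+[n∸m]≡n r<j))
  (≤-trans (m≤m+n _ _) (≤-reflexive (sym (gap r (j ∸ suc r)))))
  where
  gap : ∀ r d → (2 * r + 2 * (r + 1 + d)) * ((2 * r + 2 * (r + 1 + d)) + 4)
              ≡ 4 * ((2 * r + 1) * (2 * (r + 1 + d) + 1)) + (4 * (d * d) + 8 * d)
  gap = solve-∀

odd-am-gm : ∀ r j → r ≢ j → 4 * ((2 * r + 1) * (2 * j + 1)) ≤ (2 * r + 2 * j) * ((2 * r + 2 * j) + 4)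
odd-am-gm r j r≢j with <-cmp r j
... | tri< r<j _ _ = odd-am-gm< r j r<j
... | tri≈ _ r≡j _ = ⊥-elim (r≢j r≡j)
... | tri> _ _ j<r = subst₂ (λ a b → 4 * a ≤ b * (b + 4)) (*-comm (2 * j + 1) (2 * r + 1)) (+-comm (2 * j) (2 * r))
                       (odd-am-gm< j r j<r)

-- A cut with at least two edges: 4 v v′ ≤ (Y + 2)² ≤ 2 Y (Y + 4).
big-cut₃ : ∀ Y v v′ c → v + v′ ≡ Y + 2 → 1 ≤ Y → 2 ≤ c → 4 * (v * v′) ≤ c * (Y * (Y + 4))
big-cut₃ (suc y) v v′ c e _ 2≤c = begin
    4 * (v * v′)                ≤⟨ am-gm v v′ ⟩
    (v + v′) * (v + v′)         ≡⟨ cong (λ z → z * z) e ⟩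
    (suc y + 2) * (suc y + 2)   ≤⟨ m≤m+n _ _ ⟩
    (suc y + 2) * (suc y + 2) + (1 + 6 * y + y * y) ≡⟨ sym (gap y) ⟩
    2 * (suc y * (suc y + 4))   ≤⟨ *-monoˡ-≤ _ 2≤c ⟩
    c * (suc y * (suc y + 4))   ∎
  where
  open ≤-Reasoning
  gap : ∀ y → 2 * ((1 + y) * ((1 + y) + 4)) ≡ ((1 + y) + 2) * ((1 + y) + 2) + (1 + 6 * y + y * y)
  gap = solve-∀

-- The bound of this case for every shape, writing m = 1 + m₀ and
-- Y = n(n-1) + 2m₀ = W - 2.  Only a single cut step gives c = 1, and then
-- both volumes are odd and differ, because W ≡ 0 (mod 4).
bound₃ : ∀ q m₀ c v v′ → ¬ (4 ∣ (2 + q) * (3 + q) + 2 * suc m₀ + 2) →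
  v + v′ ≡ (suc m₀ + suc m₀) + (3 + q) * (2 + q) → Shape q (suc m₀) c v v′ →
  4 * (v * v′) ≤ c * (((2 + q) * (3 + q) + 2 * m₀) * (((2 + q) * (3 + q) + 2 * m₀) + 4))
bound₃ q m₀ c v v′ _ total (cliqueSplit R R′ a b eR eab X≤c _) =
  big-cut₃ ((2 + q) * (3 + q) + 2 * m₀) v v′ c (trans total (shift q m₀)) (s≤s z≤n)
    (≤-trans (subst (2 ≤_) (sym eab) (s≤s (s≤s z≤n))) (≤-trans (product≥sum a b) X≤c))
  where
  shift : ∀ q m₀ → (suc m₀ + suc m₀) + (3 + q) * (2 + q) ≡ ((2 + q) * (3 + q) + 2 * m₀) + 2
  shift = solve-∀
bound₃ q m₀ c v v′ _ total (severalSteps x y e 2≤c _) =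
  big-cut₃ ((2 + q) * (3 + q) + 2 * m₀) v v′ c (trans total (shift q m₀)) (s≤s z≤n) 2≤c
  where
  shift : ∀ q m₀ → (suc m₀ + suc m₀) + (3 + q) * (2 + q) ≡ ((2 + q) * (3 + q) + 2 * m₀) + 2
  shift = solve-∀
bound₃ q m₀ c v v′ ¬4∣ total (oneStep r k m≡ refl vv′≡) with consecutive-even (2 + q)
... | h , A≡ = subst₂ (λ z w → 4 * z ≤ 1 * (w * (w + 4)))
  (sym (trans vv′≡ (trans (cong (λ z → (2 * r + 1) * (2 * k + 1 + z)) A≡) (odd-volumes r k h))))
  (sym (trans (cong₂ (λ z w → z + 2 * w) A≡ (suc-injective m≡)) (middle r k h)))
  (subst (4 * ((2 * r + 1) * (2 * (k + h) + 1)) ≤_) (sym (*-identityˡ _)) (odd-am-gm r (k + h) unequal))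
  where
  odd-volumes : ∀ r k h → (2 * r + 1) * (2 * k + 1 + (h + h)) ≡ (2 * r + 1) * (2 * (k + h) + 1)
  odd-volumes = solve-∀
  middle : ∀ r k h → (h + h) + 2 * (r + k) ≡ 2 * r + 2 * (k + h)
  middle = solve-∀
  -- equal volumes would make W + 2 = 4 (k + h + 1)
  unequal : r ≢ k + h
  unequal refl = ¬4∣ (divides (suc (k + h)) (trans (cong₂ (λ z w → z + 2 * w + 2) A≡ m≡) (multiple h k)))
    where
    multiple : ∀ h k → (h + h) + 2 * (1 + (k + h) + k) + 2 ≡ suc (k + h) * 4
    multiple = solve-∀

quarter : ∀ x → 1 ≤ x → ¬ (4 ∣ (x + x) + 2) → ∃ λ j → x + x ≡ 4 * j + 4
quarter x x≥1 ¬4∣ with halve x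
... | y     , inj₂ odd  = ⊥-elim (¬4∣ (divides (suc y) (trans (cong (λ z → z + z + 2) odd) (four y))))
  where
  four : ∀ y → suc (y + y) + suc (y + y) + 2 ≡ suc y * 4
  four = solve-∀
... | zero  , inj₁ even = ⊥-elim (<-irrefl refl (subst (1 ≤_) even x≥1))
... | suc j , inj₁ even = j , trans (cong (λ z → z + z) even) (four j)
  where
  four : ∀ j → (suc j + suc j) + (suc j + suc j) ≡ 4 * j + 4
  four = solve-∀

-- If 4 ∤ W + 2, the prefix with volume W/2 - 1 is best: its volumes are
-- W/2 ∓ 1 and Ncut = 4W / ((W - 2)(W + 2)).
mcut₃ : ∀ q m₀ → ¬ (4 ∣ (2 + q) * (3 + q) + 2 * suc m₀ + 2) → (2 + q) * (3 + q) + 4 < 2 * suc m₀ →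
  IsMcut (3 + q) (suc m₀) (frac (4 * ((2 + q) * (3 + q) + 2 * suc m₀))
                                (((2 + q) * (3 + q) + 2 * m₀) * ((2 + q) * (3 + q) + 2 * (suc m₀ + 1))))
mcut₃ q m₀ ¬4∣ long = IsMcut-intro (2 + q) m P Q (s≤s z≤n) (s≤s z≤n) lower
  (S₀ , proj₁ prefix , attains (2 + q) m S₀ P Q 1 (suc (j + j)) (2 * j + 3)
                         (proj₂ (proj₂ prefix)) (proj₁ (proj₂ prefix))
                         (trans (halves j) (trans (sym W≡) (total q m₀))) ratio)
  where
  m = suc m₀
  A = (2 + q) * (3 + q)
  P = 4 * (A + 2 * m)
  Q = (A + 2 * m₀) * (A + 2 * (m + 1))
  total : ∀ q m₀ → (2 + q) * (3 + q) + 2 * suc m₀ ≡ (suc m₀ + suc m₀) + (3 + q) * (2 + q)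
  total = solve-∀
  lower : ∀ S → Proper (3 + q) m S → NcutAtLeast (3 + q) m P Q S
  lower = lower-bound q m 4 P Q (cong (4 *_) (total q m₀))
    (λ c v v′ tot shape → subst (λ z → 4 * (v * v′) ≤ c * z) (sym (Q≡ A m₀))
                                (bound₃ q m₀ c v v′ ¬4∣ tot shape))
    where
    Q≡ : ∀ A m₀ → (A + 2 * m₀) * (A + 2 * (suc m₀ + 1)) ≡ (A + 2 * m₀) * ((A + 2 * m₀) + 4)
    Q≡ = solve-∀
  -- W = 2 (h + m) where A = 2h
  h = proj₁ (consecutive-even (2 + q))
  W-even : A + 2 * m ≡ (h + m) + (h + m)
  W-even = trans (cong (_+ 2 * m) (proj₂ (consecutive-even (2 + q)))) (double h m)
    where
    double : ∀ h m → (h + h) + 2 * m ≡ (h + m) + (h + m)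
    double = solve-∀
  W-quarter = quarter (h + m) (≤-trans (s≤s z≤n) (m≤n+m m h))
                (λ 4∣ → ¬4∣ (subst (λ z → 4 ∣ z + 2) (sym W-even) 4∣))
  j = proj₁ W-quarter
  W≡ : A + 2 * m ≡ 4 * j + 4
  W≡ = trans W-even (proj₂ W-quarter)
  S₀ = initial (3 + q) m (suc j)
  prefix = path-prefix (2 + q) m j (prefix-fits A m j long
             (≤-trans (≤-reflexive (trans (four j) (sym W≡))) (m≤m+n (A + 2 * m) 2)))
    where
    four : ∀ j → 4 * suc j ≡ 4 * j + 4
    four = solve-∀
  halves : ∀ j → suc (j + j) + (2 * j + 3) ≡ 4 * j + 4
  halves = solve-∀
  -- Q = (W - 2)(W + 2) with W = 4j + 4
  Q≡ : Q ≡ (4 * j + 2) * (4 * j + 6)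
  Q≡ = cong₂ _*_ (+-cancelʳ-≡ 2 _ _ (trans (shift₁ A m₀) (trans W≡ (shift₂ j))))
                 (trans (shift₃ A m₀) (trans (cong (_+ 2) W≡) (shift₄ j)))
    where
    shift₁ : ∀ A m₀ → A + 2 * m₀ + 2 ≡ A + 2 * suc m₀
    shift₁ = solve-∀
    shift₂ : ∀ j → 4 * j + 4 ≡ 4 * j + 2 + 2
    shift₂ = solve-∀
    shift₃ : ∀ A m₀ → A + 2 * (suc m₀ + 1) ≡ A + 2 * suc m₀ + 2
    shift₃ = solve-∀
    shift₄ : ∀ j → 4 * j + 4 + 2 ≡ 4 * j + 6
    shift₄ = solve-∀
  ratio : 1 * (suc (j + j) + (2 * j + 3)) * Q ≡ P * (suc (j + j) * (2 * j + 3))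
  ratio = trans (cong (1 * (suc (j + j) + (2 * j + 3)) *_) Q≡)
                (trans (near-balanced j) (cong (λ z → 4 * z * (suc (j + j) * (2 * j + 3))) (sym W≡)))
    where
    near-balanced : ∀ j → 1 * (suc (j + j) + (2 * j + 3)) * ((4 * j + 2) * (4 * j + 6))
                        ≡ 4 * (4 * j + 4) * (suc (j + j) * (2 * j + 3))
    near-balanced = solve-∀

IsMcut-cong : ∀ n m {P P′ Q Q′} → P ≡ P′ → Q ≡ Q′ →
  IsMcut n m (frac P Q) → IsMcut n m (frac P′ Q′)
IsMcut-cong n m refl refl mcut = mcut

-- The four cases in the notation of the statement, where n(n-1) is n * n ∸ n.
case₁ : ∀ n m → 3 ≤ n → 2 ≤ m → 2 * m ≤ (n * n ∸ n) + 4 →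
  IsMcut n m (frac ((n * n ∸ n) + 2 * m) ((2 * m ∸ 1) * ((n * n ∸ n) + 1)))
case₁ (suc (suc (suc q))) (suc (suc t)) (s≤s (s≤s (s≤s z≤n))) (s≤s (s≤s z≤n)) short =
  IsMcut-cong (3 + q) (2 + t) (cong (_+ 2 * (2 + t)) (sym A≡)) (cong₂ _*_ (odd t) (cong (_+ 1) (sym A≡)))
    (mcut₁ q t 2t≤A)
  where
  A≡ = clique-volume q
  odd : ∀ t → 3 + 2 * t ≡ 2 * (2 + t) ∸ 1
  odd t = cong pred (lengths t)
    where
    lengths : ∀ t → 4 + 2 * t ≡ 2 * (2 + t)
    lengths = solve-∀
  2t≤A : 2 * t ≤ (2 + q) * (3 + q)
  2t≤A = +-cancelʳ-≤ 4 (2 * t) _ (subst₂ _≤_ (shift t) (cong (_+ 4) A≡) short)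
    where
    shift : ∀ t → 2 * (2 + t) ≡ 2 * t + 4
    shift = solve-∀

case₂ : ∀ n m → 3 ≤ n → 4 ∣ (n * n ∸ n) + 2 * m + 2 → (n * n ∸ n) + 4 < 2 * m →
  IsMcut n m (frac 4 ((n * n ∸ n) + 2 * m))
case₂ (suc (suc (suc q))) m (s≤s (s≤s (s≤s z≤n))) 4∣ long =
  IsMcut-cong (3 + q) m refl (cong (_+ 2 * m) (sym A≡))
    (mcut₂ q m (subst (λ A → 4 ∣ A + 2 * m + 2) A≡ 4∣) (subst (λ A → A + 4 < 2 * m) A≡ long))
  where A≡ = clique-volume q

case₃ : ∀ n m → 3 ≤ n → ¬ (4 ∣ (n * n ∸ n) + 2 * m + 2) → (n * n ∸ n) + 4 < 2 * m →
  IsMcut n m (frac (4 * ((n * n ∸ n) + 2 * m)) (((n * n ∸ n) + 2 * (m ∸ 1)) * ((n * n ∸ n) + 2 * (m + 1))))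
case₃ (suc (suc (suc q))) zero     (s≤s (s≤s (s≤s z≤n))) _   ()
case₃ (suc (suc (suc q))) (suc m₀) (s≤s (s≤s (s≤s z≤n))) ¬4∣ long =
  IsMcut-cong (3 + q) (suc m₀) (cong (λ A → 4 * (A + 2 * suc m₀)) (sym A≡))
              (cong (λ A → (A + 2 * m₀) * (A + 2 * (suc m₀ + 1))) (sym A≡))
    (mcut₃ q m₀ (λ 4∣ → ¬4∣ (subst (λ A → 4 ∣ A + 2 * suc m₀ + 2) (sym A≡) 4∣))
                (subst (λ A → A + 4 < 2 * suc m₀) A≡ long))
  where A≡ = clique-volume q

case₄ : ∀ n m → 3 ≤ n → m ≡ 1 → IsMcut n m (frac ((n * n ∸ n) + 2) ((n + 1) * (n ∸ 1)))
case₄ (suc (suc (suc q))) .1 (s≤s (s≤s (s≤s z≤n))) refl =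
  IsMcut-cong (3 + q) 1 (cong (_+ 2) (sym (clique-volume q))) (cong (_* (2 + q)) (+-comm 1 (3 + q))) (mcut₄ q)

theorem4 : (n m : ℕ) → 3 ≤ n → 1 ≤ m →
  ((2 ≤ m → 2 * m ≤ (n * n ∸ n) + 4 →
      IsMcut n m (frac ((n * n ∸ n) + 2 * m) ((2 * m ∸ 1) * ((n * n ∸ n) + 1))))
  × (4 ∣ (n * n ∸ n) + 2 * m + 2 → (n * n ∸ n) + 4 < 2 * m →
      IsMcut n m (frac 4 ((n * n ∸ n) + 2 * m)))
  × (¬ (4 ∣ (n * n ∸ n) + 2 * m + 2) → (n * n ∸ n) + 4 < 2 * m →
      IsMcut n m (frac (4 * ((n * n ∸ n) + 2 * m))
        (((n * n ∸ n) + 2 * (m ∸ 1)) * ((n * n ∸ n) + 2 * (m + 1)))))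
  × (m ≡ 1 → IsMcut n m (frac ((n * n ∸ n) + 2) ((n + 1) * (n ∸ 1)))))
theorem4 n m n≥3 _ = case₁ n m n≥3 , case₂ n m n≥3 , case₃ n m n≥3 , case₄ n m n≥3
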